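{- Let $m\geq 1$, $S=\{1,2,\ldots,2m+1\}$, $x_0=\{1,2,\ldots,m\}$, and for subsets $y,z\subseteq S$ put $\varrho(y,z)=(|x_0\cap y|,\,|x_0\cap z|,\,|y\cap z|,\,|x_0\cap y\cap z|)$. For $a,b\in\{m,m+1\}$ let $\mathcal{I}_{(a,b)}=\{\varrho(y,z)\mid y,z\subseteq S,\ |y|=a,\ |z|=b\}$. Then: (i) $\mathcal{I}_{(m,m)}$ is the set of all integer four-tuples $(i,j,t,p)$ with $0\leq i,j\leq m$, $\max\{i+j-m,\,m-1-i-j\}\leq t\leq m-|i-j|$, and $\max\{0,\,i+j-m,\,i+t-m,\,j+t-m\}\leq p\leq \min\{i,\,j,\,t,\,i+j+t+1-m\}$; moreover $|\mathcal{I}_{(m,m)}|=\binom{m+4}{4}$. (ii) $\mathcal{I}_{(m,m+1)}$ is the set of all integer four-tuples $(i,j,t,p)$ with $0\leq i,j\leq m$, $|i+j-m|\leq t\leq m-\max\{i-j,\,j-i-1\}$, and $i-\min\{i,\,m-j,\,m-t,\,i-j-t+m+1\}\leq p\leq i-\max\{0,\,i-j,\,i-t,\,m-j-t\}$; moreover $|\mathcal{I}_{(m,m+1)}|=\binom{m+4}{4}$. (iii) $\mathcal{I}_{(m+1,m)}$ is the set of all integer four-tuples $(i,j,t,p)$ with $0\leq i,j\leq m$, $|i+j-m|\leq t\leq m-\max\{i-j-1,\,j-i\}$, and $j-\min\{m-i,\,j,\,m-t,\,j-i-t+m+1\}\leq p\leq j-\max\{0,\,j-i,\,j-t,\,m-i-t\}$;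 moreover $|\mathcal{I}_{(m+1,m)}|=\binom{m+4}{4}$. (iv) $\mathcal{I}_{(m+1,m+1)}$ is the set of all integer four-tuples $(i,j,t,p)$ with $0\leq i,j\leq m$, $1+\max\{i+j-m-1,\,m-i-j\}\leq t\leq m+1-|i-j|$, and $i+j-m+\max\{0,\,m-i-j,\,t-i-1,\,t-j-1\}\leq p\leq i+j-m+\min\{m-i,\,m-j,\,t-1,\,m-i-j+t\}$; moreover $|\mathcal{I}_{(m+1,m+1)}|=\binom{m+4}{4}$. -}

module Defs where

open import Data.Nat as ℕ using (ℕ; suc; _<ᵇ_)
open import Data.Nat.Combinatorics using (_C_)
open import Data.Bool using (Bool)
open import Data.Fin using (Fin; toℕ)
open import Data.Fin.Subset as Sub using (Subset; _∩_)
open import Data.Vec using (tabulate)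
open import Data.Integer using (ℤ; +_; _+_; _-_; _≤_; _⊔_; _⊓_; ∣_∣)
open import Data.Product using (_×_; _,_; ∃-syntax)
open import Data.List using (List; length)
open import Data.List.Membership.Propositional using (_∈_)
open import Data.List.Relation.Unary.Unique.Propositional using (Unique)
open import Function.Bundles using (_⇔_)
open import Relation.Binary.PropositionalEquality using (_≡_)

-- S = {1,…,2m+1} is modelled as Fin (2m+1) (element k ↦ k+1);
-- subsets of S are 'Subset (2m+1)'.
Sₙ : ℕ → ℕ
Sₙ m = suc (m ℕ.+ m)

x₀ : (m : ℕ) → Subset (Sₙ m)
x₀ m = tabulate (λ k → toℕ k <ᵇ m)

Quad : Set
Quad = ℤ × ℤ × ℤ × ℤ

ρ : (m : ℕ) → Subset (Sₙ m) → Subset (Sₙ m) → Quad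
ρ m y z = + Sub.∣ x₀ m ∩ y ∣ , + Sub.∣ x₀ m ∩ z ∣ , + Sub.∣ y ∩ z ∣ , + Sub.∣ x₀ m ∩ y ∩ z ∣

In𝓘 : (m a b : ℕ) → Quad → Set
In𝓘 m a b q = ∃[ y ] ∃[ z ] (Sub.∣ y ∣ ≡ a × Sub.∣ z ∣ ≡ b × ρ m y z ≡ q)

HasCard : (Quad → Set) → ℕ → Set
HasCard P n = ∃[ L ] (Unique L × (∀ q → (q ∈ L) ⇔ P q) × length L ≡ n)

Describes : (m a b : ℕ) → (Quad → Set) → Set
Describes m a b Cnd = (∀ q → In𝓘 m a b q ⇔ Cnd q) × HasCard (In𝓘 m a b) ((m ℕ.+ 4) C 4)

absℤ : ℤ → ℤ
absℤ x = + ∣ x ∣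

_≤_≤_ : ℤ → ℤ → ℤ → Set
a ≤ b ≤ c = (a ≤ b) × (b ≤ c)
infix 4 _≤_≤_

Cond-mm : ℕ → Quad → Set
Cond-mm m (i , j , t , p) =
  (+ 0 ≤ i ≤ M) × (+ 0 ≤ j ≤ M)
  × (((i + j - M) ⊔ (M - + 1 - i - j)) ≤ t ≤ (M - absℤ (i - j)))
  × ((+ 0 ⊔ (i + j - M) ⊔ (i + t - M) ⊔ (j + t - M)) ≤ p ≤ (i ⊓ j ⊓ t ⊓ (i + j + t + + 1 - M)))
  where M = + m

Cond-mm1 : ℕ → Quad → Set
Cond-mm1 m (i , j , t , p) =
  (+ 0 ≤ i ≤ M) × (+ 0 ≤ j ≤ M)
  × (absℤ (i + j - M) ≤ t ≤ (M - ((i - j) ⊔ (j - i - + 1))))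
  × ((i - (i ⊓ (M - j) ⊓ (M - t) ⊓ (i - j - t + M + + 1))) ≤ p ≤ (i - (+ 0 ⊔ (i - j) ⊔ (i - t) ⊔ (M - j - t))))
  where M = + m

Cond-m1m : ℕ → Quad → Set
Cond-m1m m (i , j , t , p) =
  (+ 0 ≤ i ≤ M) × (+ 0 ≤ j ≤ M)
  × (absℤ (i + j - M) ≤ t ≤ (M - ((i - j - + 1) ⊔ (j - i))))
  × ((j - ((M - i) ⊓ j ⊓ (M - t) ⊓ (j - i - t + M + + 1))) ≤ p ≤ (j - (+ 0 ⊔ (j - i) ⊔ (j - t) ⊔ (M - i - t))))
  where M = + m

Cond-m1m1 : ℕ → Quad → Set
Cond-m1m1 m (i , j , t , p) =
  (+ 0 ≤ i ≤ M) × (+ 0 ≤ j ≤ M)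
  × ((+ 1 + ((i + j - M - + 1) ⊔ (M - i - j))) ≤ t ≤ (M + + 1 - absℤ (i - j)))
  × ((i + j - M + (+ 0 ⊔ (M - i - j) ⊔ (t - i - + 1) ⊔ (t - j - + 1))) ≤ p
       ≤ (i + j - M + ((M - i) ⊓ (M - j) ⊓ (t - + 1) ⊓ (M - i - j + t))))
  where M = + m

-- The sets x₀, y, z cut S into eight cells: inside or outside x₀, in or out of y, in or out
-- of z. The entries of ρ(y, z), the sizes |y|, |z|, |x₀| = m and |S ─ x₀| = m + 1 are sums of cell sizes,
-- and conversely, for ρ(y, z) = (i, j, t, p), |y| = a and |z| = b the cells have the sizes
--   p, i - p, j - p, m - i - j + p,  t - p, a - i - t + p, b - j - t + p, m + 1 - a - b + i + j + t - p.
-- Since cells of any prescribed sizes can be realised, 𝓘_(a,b) consists of the quadruples for which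
-- these eight numbers are nonnegative, and each of (i)-(iv) is a rearrangement of these inequalities.
-- Complementing z (or y) permutes the cells, so it maps 𝓘_(a,b) bijectively onto 𝓘_(a,2m+1-b) (or
-- 𝓘_(2m+1-a,b)), and all four sets are as large as 𝓘_(m,m). The latter is parametrised by
-- (a, u, v, w) = (p, i - p, j - p, t - p) subject to a + u + v, a + u + w, a + v + w ≤ m ≤ 2a + u + v + w + 1,
-- and these points correspond to the C(m+4,4) compositions (a', u', v', w', k) of m into five parts:
-- for k = 2e the point is (a', u' + e, v' + e, w' + e), for k = 2e + 1 it is (a' + e, u', v', w');
-- the two cases are told apart by whether a + u + v + w ≥ m.
module Submission where

open import Defs
open import Data.Nat using (ℕ; suc; _≤_)
import Data.Nat as ℕ
import Data.Nat.Properties as ℕP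
open import Data.Nat.Combinatorics using (_C_)
open import Data.Bool using (Bool; true; false)
open import Data.Empty using (⊥; ⊥-elim)
open import Data.Product using (_×_; _,_; proj₁; proj₂; map₁; map₂; ∃-syntax)
open import Data.List using (List; []; _∷_; _++_; map; length)
open import Data.List.Properties using (length-map; length-++)
open import Data.List.Membership.Propositional using (_∈_)
open import Data.List.Membership.Propositional.Properties using (∈-map⁺; ∈-map⁻; ∈-++⁺ˡ; ∈-++⁺ʳ; ∈-++⁻)
open import Data.List.Relation.Unary.Any using (here; there)
import Data.List.Relation.Unary.All as All
import Data.List.Relation.Unary.All.Properties as All
open import Data.List.Relation.Unary.AllPairs using ([]; _∷_)
open import Data.List.Relation.Unary.Unique.Propositional using (Unique)
import Data.List.Relation.Unary.Unique.Propositional.Properties as Unique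
open import Data.Sum using (inj₁; inj₂)
open import Function using (_∘_; _∘′_)
open import Function.Bundles using (_⇔_; mk⇔; Equivalence)
open import Function.Construct.Composition using (_⇔-∘_)
open import Function.Construct.Symmetry using (⇔-sym)
open import Data.Fin using (toℕ)
open import Data.Fin.Subset using (Subset; _∩_; ∁)
import Data.Fin.Subset as Subset
open import Data.Fin.Subset.Properties using (∣∁p∣≡n∸∣p∣)
open import Relation.Nullary using (yes; no)
open import Relation.Binary.PropositionalEquality

private variable
  A B : Set
  P Q : A → Set
  xs : List A

Enumerates : (A → Set) → List A → Set
Enumerates P xs = Unique xs × (∀ x → x ∈ xs ⇔ P x)

Image : (A → B) → (A → Set) → B → Set
Image f P y = ∃[ x ] (P x × f x ≡ y)

≡-quadruple : ∀ {W X Y Z : Set} {w w' : W} {x x' : X} {y y' : Y} {z z' : Z} →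
              w ≡ w' → x ≡ x' → y ≡ y' → z ≡ z' → (w , x , y , z) ≡ (w' , x' , y' , z')
≡-quadruple refl refl refl refl = refl

enumerates-⇔ : (∀ x → P x ⇔ Q x) → Enumerates P xs → Enumerates Q xs
enumerates-⇔ P⇔Q (unique , ∈⇔P) = unique , λ x → P⇔Q x ⇔-∘ ∈⇔P x

unique-map : (f : A → B) → (∀ {x y} → x ∈ xs → y ∈ xs → f x ≡ f y → x ≡ y) →
             Unique xs → Unique (map f xs)
unique-map f injective []                 = []
unique-map f injective (x∉xs ∷ unique-xs) =
  All.map⁺ (All.tabulate λ y∈xs fx≡fy → All.lookup x∉xs y∈xs (injective (here refl) (there y∈xs) fx≡fy))
  ∷ unique-map f (λ x∈xs y∈xs → injective (there x∈xs) (there y∈xs)) unique-xs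

enumerates-image : (f : A → B) → (∀ {x y} → P x → P y → f x ≡ f y → x ≡ y) →
                   Enumerates P xs → Enumerates (Image f P) (map f xs)
enumerates-image {P = P} {xs = xs} f injective (unique , ∈⇔P) =
  unique-map f (λ x∈xs y∈xs → injective (member x∈xs) (member y∈xs)) unique , λ y → mk⇔ to from
  where
  member : ∀ {x} → x ∈ xs → P x
  member {x} = Equivalence.to (∈⇔P x)
  to : ∀ {y} → y ∈ map f xs → Image f P y
  to y∈fxs with ∈-map⁻ f y∈fxs
  ... | x , x∈xs , refl = x , member x∈xs , refl
  from : ∀ {y} → Image f P y → y ∈ map f xs
  from (x , Px , refl) = ∈-map⁺ f (Equivalence.from (∈⇔P x) Px)

enumerates-involution : (f : A → A) → (∀ x → f (f x) ≡ x) →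
                        (∀ x → P x → Q (f x)) → (∀ x → Q x → P (f x)) →
                        Enumerates P xs → Enumerates Q (map f xs)
enumerates-involution {P = P} {Q = Q} f involutive P⇒Q Q⇒P =
  enumerates-⇔ image⇔Q ∘ enumerates-image f (λ _ _ → injective)
  where
  injective : ∀ {x y} → f x ≡ f y → x ≡ y
  injective {x} {y} fx≡fy = trans (sym (involutive x)) (trans (cong f fx≡fy) (involutive y))
  image⇔Q : ∀ y → Image f P y ⇔ Q y
  image⇔Q y = mk⇔ (λ { (x , Px , refl) → P⇒Q x Px }) (λ Qy → f y , Q⇒P y Qy , involutive y)

module Compositions where

  open import Data.Nat using (zero; _+_)
  open import Data.Nat.Combinatorics using (nCn≡1; nCk+nC[k+1]≡[n+1]C[k+1])
  open import Data.Nat.Tactic.RingSolver using (solve-∀)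
  open import Data.Vec using (Vec; []; _∷_; sum)
  open import Data.Vec.Properties using (∷-injectiveʳ)

  incrementHead : ∀ {k} → Vec ℕ (suc k) → Vec ℕ (suc k)
  incrementHead (x ∷ xs) = suc x ∷ xs

  incrementHead-injective : ∀ {k} {xs ys : Vec ℕ (suc k)} → incrementHead xs ≡ incrementHead ys → xs ≡ ys
  incrementHead-injective {xs = _ ∷ _} {_ ∷ _} refl = refl

  compositions : (k n : ℕ) → List (Vec ℕ (suc k))
  compositions zero    n       = (n ∷ []) ∷ []
  compositions (suc k) zero    = map (0 ∷_) (compositions k zero)
  compositions (suc k) (suc n) = map (0 ∷_) (compositions k (suc n)) ++ map incrementHead (compositions (suc k) n)

  ∈-compositions⁻ : ∀ k n {v} → v ∈ compositions k n → sum v ≡ n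
  ∈-compositions⁻ zero n (here refl) = ℕP.+-identityʳ n
  ∈-compositions⁻ (suc k) zero v∈ with ∈-map⁻ (0 ∷_) v∈
  ... | w , w∈ , refl = ∈-compositions⁻ k zero w∈
  ∈-compositions⁻ (suc k) (suc n) v∈ with ∈-++⁻ (map (0 ∷_) (compositions k (suc n))) v∈
  ... | inj₁ v∈₁ with ∈-map⁻ (0 ∷_) v∈₁
  ...   | w , w∈ , refl = ∈-compositions⁻ k (suc n) w∈
  ∈-compositions⁻ (suc k) (suc n) v∈ | inj₂ v∈₂ with ∈-map⁻ incrementHead v∈₂
  ...   | _ ∷ _ , w∈ , refl = cong suc (∈-compositions⁻ (suc k) n w∈)

  ∈-compositions⁺ : ∀ k n (v : Vec ℕ (suc k)) → sum v ≡ n → v ∈ compositions k n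
  ∈-compositions⁺ zero    n       (x ∷ [])    refl = here (cong (_∷ []) (sym (ℕP.+-identityʳ x)))
  ∈-compositions⁺ (suc k) zero    (zero ∷ v)  Σv≡0 = ∈-map⁺ (0 ∷_) (∈-compositions⁺ k zero v Σv≡0)
  ∈-compositions⁺ (suc k) (suc n) (zero ∷ v)  Σv≡n =
    ∈-++⁺ˡ (∈-map⁺ (0 ∷_) (∈-compositions⁺ k (suc n) v Σv≡n))
  ∈-compositions⁺ (suc k) (suc n) (suc x ∷ v) Σv≡n =
    ∈-++⁺ʳ (map (0 ∷_) (compositions k (suc n)))
           (∈-map⁺ incrementHead (∈-compositions⁺ (suc k) n (x ∷ v) (ℕP.suc-injective Σv≡n)))

  compositions-unique : ∀ k n → Unique (compositions k n)
  compositions-unique zero    n       = All.[] ∷ []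
  compositions-unique (suc k) zero    = Unique.map⁺ ∷-injectiveʳ (compositions-unique k zero)
  compositions-unique (suc k) (suc n) =
    Unique.++⁺ (Unique.map⁺ ∷-injectiveʳ (compositions-unique k (suc n)))
               (Unique.map⁺ incrementHead-injective (compositions-unique (suc k) n))
               disjoint
    where
    disjoint : ∀ {v} → v ∈ map (0 ∷_) (compositions k (suc n)) × v ∈ map incrementHead (compositions (suc k) n) → ⊥
    disjoint (v∈₁ , v∈₂) with ∈-map⁻ (0 ∷_) v∈₁ | ∈-map⁻ incrementHead v∈₂
    ... | _ , _ , refl | _ ∷ _ , _ , ()

  compositions-enumerates : ∀ k n → Enumerates (λ v → sum v ≡ n) (compositions k n)
  compositions-enumerates k n =
    compositions-unique k n , λ v → mk⇔ (∈-compositions⁻ k n) (∈-compositions⁺ k n v)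

  length-compositions : ∀ k n → length (compositions k n) ≡ (n + k) C k
  length-compositions zero    n       = refl
  length-compositions (suc k) zero    = begin
    length (map (0 ∷_) (compositions k zero)) ≡⟨ length-map (0 ∷_) (compositions k zero) ⟩
    length (compositions k zero)              ≡⟨ length-compositions k zero ⟩
    k C k                                     ≡⟨ nCn≡1 k ⟩
    1                                         ≡⟨ nCn≡1 (suc k) ⟨
    suc k C suc k                             ∎
    where open ≡-Reasoning
  length-compositions (suc k) (suc n) = begin
    length (map (0 ∷_) (compositions k (suc n)) ++ map incrementHead (compositions (suc k) n))
      ≡⟨ length-++ (map (0 ∷_) (compositions k (suc n))) ⟩
    length (map (0 ∷_) (compositions k (suc n))) + length (map incrementHead (compositions (suc k) n))
      ≡⟨ cong₂ _+_ (length-map (0 ∷_) (compositions k (suc n))) (length-map incrementHead (compositions (suc k) n)) ⟩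
    length (compositions k (suc n)) + length (compositions (suc k) n)
      ≡⟨ cong₂ _+_ (length-compositions k (suc n)) (length-compositions (suc k) n) ⟩
    (suc n + k) C k + (n + suc k) C suc k
      ≡⟨ cong (λ l → l C k + (n + suc k) C suc k) (sym (ℕP.+-suc n k)) ⟩
    (n + suc k) C k + (n + suc k) C suc k
      ≡⟨ nCk+nC[k+1]≡[n+1]C[k+1] (n + suc k) k ⟩
    suc (n + suc k) C suc k ∎
    where open ≡-Reasoning

  Composition : ℕ → ℕ × ℕ × ℕ × ℕ × ℕ → Set
  Composition n (a , u , v , w , k) = a + u + v + w + k ≡ n

  toQuintuple : Vec ℕ 5 → ℕ × ℕ × ℕ × ℕ × ℕ
  toQuintuple (a ∷ u ∷ v ∷ w ∷ k ∷ []) = a , u , v , w , k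

  toQuintuple-injective : ∀ {xs ys} → toQuintuple xs ≡ toQuintuple ys → xs ≡ ys
  toQuintuple-injective {_ ∷ _ ∷ _ ∷ _ ∷ _ ∷ []} {_ ∷ _ ∷ _ ∷ _ ∷ _ ∷ []} refl = refl

  quintuples : ℕ → List (ℕ × ℕ × ℕ × ℕ × ℕ)
  quintuples n = map toQuintuple (compositions 4 n)

  quintuples-enumerates : ∀ n → Enumerates (Composition n) (quintuples n)
  quintuples-enumerates n =
    enumerates-⇔ image⇔sum (enumerates-image toQuintuple (λ _ _ → toQuintuple-injective) (compositions-enumerates 4 n))
    where
    sum≡ : ∀ a u v w k → a + (u + (v + (w + (k + 0)))) ≡ a + u + v + w + k
    sum≡ = solve-∀
    image⇔sum : ∀ q → Image toQuintuple (λ xs → sum xs ≡ n) q ⇔ Composition n q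
    image⇔sum (a , u , v , w , k) = mk⇔
      (λ { ((a ∷ u ∷ v ∷ w ∷ k ∷ []) , Σ≡n , refl) → trans (sym (sum≡ a u v w k)) Σ≡n })
      (λ Σ≡n → (a ∷ u ∷ v ∷ w ∷ k ∷ []) , trans (sum≡ a u v w k) Σ≡n , refl)

  length-quintuples : ∀ n → length (quintuples n) ≡ (n + 4) C 4
  length-quintuples n = trans (length-map toQuintuple (compositions 4 n)) (length-compositions 4 n)

module AdmissiblePoints where

  open import Data.Nat using (zero; _+_; _∸_; _<_; _≤?_)
  open import Data.Nat.Tactic.RingSolver using (solve-∀)
  open Compositions using (Composition; quintuples; quintuples-enumerates)

  m+o≡n⇒m≤n : ∀ {m n} o → m + o ≡ n → m ≤ n
  m+o≡n⇒m≤n o refl = ℕP.m≤m+n _ o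

  double : ℕ × Bool → ℕ
  double (e , false) = e + e
  double (e , true)  = suc (e + e)

  next : ℕ × Bool → ℕ × Bool
  next (e , false) = e , true
  next (e , true)  = suc e , false

  halve : ℕ → ℕ × Bool
  halve zero    = 0 , false
  halve (suc k) = next (halve k)

  double-halve : ∀ k → double (halve k) ≡ k
  double-halve zero    = refl
  double-halve (suc k) = trans (double-next (halve k)) (cong suc (double-halve k))
    where
    double-next : ∀ p → double (next p) ≡ suc (double p)
    double-next (e , false) = refl
    double-next (e , true)  = cong suc (ℕP.+-suc e e)

  halve-double : ∀ p → halve (double p) ≡ p
  halve-double (zero  , false) = refl
  halve-double (zero  , true)  = refl
  halve-double (suc e , δ)     = begin
    halve (double (suc e , δ))         ≡⟨ cong halve (double-suc δ) ⟩
    next (next (halve (double (e , δ)))) ≡⟨ cong (next ∘′ next) (halve-double (e , δ)) ⟩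
    next (next (e , δ))                ≡⟨ next-next δ ⟩
    suc e , δ                          ∎
    where
    open ≡-Reasoning
    double-suc : ∀ δ → double (suc e , δ) ≡ suc (suc (double (e , δ)))
    double-suc false = cong suc (ℕP.+-suc e e)
    double-suc true  = cong (suc ∘′ suc) (ℕP.+-suc e e)
    next-next : ∀ δ → next (next (e , δ)) ≡ (suc e , δ)
    next-next false = refl
    next-next true  = refl

  Point : Set
  Point = ℕ × ℕ × ℕ × ℕ

  total : Point → ℕ
  total (a , u , v , w) = a + u + v + w

  Admissible : ℕ → Point → Set
  Admissible m (a , u , v , w) =
    (a + u + v ≤ m) × (a + u + w ≤ m) × (a + v + w ≤ m) × (m ≤ suc (a + a + u + v + w))

  spread : ℕ × Bool → Point → Point
  spread (e , false) (a , u , v , w) = a , u + e , v + e , w + e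
  spread (e , true)  (a , u , v , w) = a + e , u , v , w

  spread-admissible : ∀ c p → Admissible (total c + double p) (spread p c)
  spread-admissible (a , u , v , w) (e , false) =
    m+o≡n⇒m≤n w (slack₁ a u v w e) , m+o≡n⇒m≤n v (slack₂ a u v w e)
    , m+o≡n⇒m≤n u (slack₃ a u v w e) , m+o≡n⇒m≤n (suc (a + e)) (slack₄ a u v w e)
    where
    slack₁ : ∀ a u v w e → a + (u + e) + (v + e) + w ≡ a + u + v + w + (e + e)
    slack₁ = solve-∀
    slack₂ : ∀ a u v w e → a + (u + e) + (w + e) + v ≡ a + u + v + w + (e + e)
    slack₂ = solve-∀
    slack₃ : ∀ a u v w e → a + (v + e) + (w + e) + u ≡ a + u + v + w + (e + e)
    slack₃ = solve-∀
    slack₄ : ∀ a u v w e → a + u + v + w + (e + e) + suc (a + e) ≡ suc (a + a + (u + e) + (v + e) + (w + e))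
    slack₄ = solve-∀
  spread-admissible (a , u , v , w) (e , true) =
    m+o≡n⇒m≤n (suc (w + e)) (slack₁ a u v w e) , m+o≡n⇒m≤n (suc (v + e)) (slack₂ a u v w e)
    , m+o≡n⇒m≤n (suc (u + e)) (slack₃ a u v w e) , m+o≡n⇒m≤n a (slack₄ a u v w e)
    where
    slack₁ : ∀ a u v w e → a + e + u + v + suc (w + e) ≡ a + u + v + w + suc (e + e)
    slack₁ = solve-∀
    slack₂ : ∀ a u v w e → a + e + u + w + suc (v + e) ≡ a + u + v + w + suc (e + e)
    slack₂ = solve-∀
    slack₃ : ∀ a u v w e → a + e + v + w + suc (u + e) ≡ a + u + v + w + suc (e + e)
    slack₃ = solve-∀
    slack₄ : ∀ a u v w e → a + u + v + w + suc (e + e) + a ≡ suc (a + e + (a + e) + u + v + w)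
    slack₄ = solve-∀

  cancel-slack : ∀ k x s e {m} → k + s ≡ m → m + e ≡ k + x → x ≡ s + e
  cancel-slack k x s e refl eq = ℕP.+-cancelˡ-≡ k x (s + e) (trans (sym eq) (ℕP.+-assoc k s e))

  admissible⇒spread-even : ∀ {m} x → Admissible m x → m ≤ total x →
                           ∃[ c ] ∃[ p ] (total c + double p ≡ m × spread p c ≡ x)
  admissible⇒spread-even {m} (a , u , v , w) (h₁ , h₂ , h₃ , _) m≤s
    with e , m+e≡s ← ℕP.m≤n⇒∃[o]m+o≡n m≤s
       | s₁ , e₁ ← ℕP.m≤n⇒∃[o]m+o≡n h₁
       | s₂ , e₂ ← ℕP.m≤n⇒∃[o]m+o≡n h₂
       | s₃ , e₃ ← ℕP.m≤n⇒∃[o]m+o≡n h₃ =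
    (a , s₃ , s₂ , s₁) , (e , false) , total≡m , sym (≡-quadruple refl u≡ v≡ w≡)
    where
    u≡ : u ≡ s₃ + e
    u≡ = cancel-slack (a + v + w) u s₃ e e₃ (trans m+e≡s (regroup a u v w))
      where regroup : ∀ a u v w → a + u + v + w ≡ a + v + w + u
            regroup = solve-∀
    v≡ : v ≡ s₂ + e
    v≡ = cancel-slack (a + u + w) v s₂ e e₂ (trans m+e≡s (regroup a u v w))
      where regroup : ∀ a u v w → a + u + v + w ≡ a + u + w + v
            regroup = solve-∀
    w≡ : w ≡ s₁ + e
    w≡ = cancel-slack (a + u + v) w s₁ e e₁ m+e≡s
    total≡m : a + s₃ + s₂ + s₁ + (e + e) ≡ m
    total≡m = ℕP.+-cancelʳ-≡ e _ _ (begin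
      a + s₃ + s₂ + s₁ + (e + e) + e      ≡⟨ regroup a s₁ s₂ s₃ e ⟩
      a + (s₃ + e) + (s₂ + e) + (s₁ + e)  ≡⟨ cong₂ _+_ (cong₂ (λ x y → a + x + y) u≡ v≡) w≡ ⟨
      a + u + v + w                       ≡⟨ m+e≡s ⟨
      m + e                               ∎)
      where
      open ≡-Reasoning
      regroup : ∀ a s₁ s₂ s₃ e → a + s₃ + s₂ + s₁ + (e + e) + e ≡ a + (s₃ + e) + (s₂ + e) + (s₁ + e)
      regroup = solve-∀

  admissible⇒spread-odd : ∀ {m} x → Admissible m x → total x < m →
                          ∃[ c ] ∃[ p ] (total c + double p ≡ m × spread p c ≡ x)
  admissible⇒spread-odd {m} (a , u , v , w) (_ , _ , _ , h₄) s<m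
    with d , 1+s+d≡m ← ℕP.m≤n⇒∃[o]m+o≡n s<m
       | s₄ , e₄ ← ℕP.m≤n⇒∃[o]m+o≡n h₄ =
    (s₄ , u , v , w) , (d , true) , total≡m , ≡-quadruple (sym a≡) refl refl refl
    where
    open ≡-Reasoning
    a≡ : a ≡ s₄ + d
    a≡ = ℕP.+-cancelˡ-≡ (suc (a + u + v + w)) a (s₄ + d) (begin
      suc (a + u + v + w) + a        ≡⟨ regroup₁ a u v w ⟩
      suc (a + a + u + v + w)        ≡⟨ e₄ ⟨
      m + s₄                         ≡⟨ cong (_+ s₄) 1+s+d≡m ⟨
      suc (a + u + v + w) + d + s₄   ≡⟨ regroup₂ (suc (a + u + v + w)) d s₄ ⟩
      suc (a + u + v + w) + (s₄ + d) ∎)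
      where
      regroup₁ : ∀ a u v w → suc (a + u + v + w) + a ≡ suc (a + a + u + v + w)
      regroup₁ = solve-∀
      regroup₂ : ∀ x d s → x + d + s ≡ x + (s + d)
      regroup₂ = solve-∀
    total≡m : s₄ + u + v + w + suc (d + d) ≡ m
    total≡m = begin
      s₄ + u + v + w + suc (d + d)  ≡⟨ regroup s₄ u v w d ⟩
      suc (s₄ + d + u + v + w) + d  ≡⟨ cong (λ x → suc (x + u + v + w) + d) a≡ ⟨
      suc (a + u + v + w) + d       ≡⟨ 1+s+d≡m ⟩
      m                             ∎
      where
      regroup : ∀ s₄ u v w d → s₄ + u + v + w + suc (d + d) ≡ suc (s₄ + d + u + v + w) + d
      regroup = solve-∀

  admissible⇒spread : ∀ {m} x → Admissible m x → ∃[ c ] ∃[ p ] (total c + double p ≡ m × spread p c ≡ x)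
  admissible⇒spread {m} x admissible with m ≤? total x
  ... | yes m≤s = admissible⇒spread-even x admissible m≤s
  ... | no  m≰s = admissible⇒spread-odd x admissible (ℕP.≰⇒> m≰s)

  unspread : ℕ × Bool → Point → Point
  unspread (e , false) (a , u , v , w) = a , u ∸ e , v ∸ e , w ∸ e
  unspread (e , true)  (a , u , v , w) = a ∸ e , u , v , w

  unspread-spread : ∀ p c → unspread p (spread p c) ≡ c
  unspread-spread (e , false) (a , u , v , w) = ≡-quadruple refl (ℕP.m+n∸n≡m u e) (ℕP.m+n∸n≡m v e) (ℕP.m+n∸n≡m w e)
  unspread-spread (e , true)  (a , u , v , w) = ≡-quadruple (ℕP.m+n∸n≡m a e) refl refl refl

  total-spread-false : ∀ e c → total (spread (e , false) c) ≡ total c + double (e , false) + e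
  total-spread-false e (a , u , v , w) = regroup a u v w e
    where regroup : ∀ a u v w e → a + (u + e) + (v + e) + (w + e) ≡ a + u + v + w + (e + e) + e
          regroup = solve-∀

  total-spread-true : ∀ e c → total (spread (e , true) c) + suc e ≡ total c + double (e , true)
  total-spread-true e (a , u , v , w) = regroup a u v w e
    where regroup : ∀ a u v w e → a + e + u + v + w + suc e ≡ a + u + v + w + suc (e + e)
          regroup = solve-∀

  even-odd-clash : ∀ {m} c c' e e' → total c + double (e , false) ≡ m → total c' + double (e' , true) ≡ m →
                   total (spread (e , false) c) ≢ total (spread (e' , true) c')
  even-odd-clash c c' e e' refl Σ'≡m S≡S' = ℕP.m+1+n≢m (total c + double (e , false)) (begin
    total c + double (e , false) + suc (e + e')   ≡⟨ regroup (total c + double (e , false)) e e' ⟩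
    total c + double (e , false) + e + suc e'     ≡⟨ cong (_+ suc e') (trans (sym (total-spread-false e c)) S≡S') ⟩
    total (spread (e' , true) c') + suc e'        ≡⟨ trans (total-spread-true e' c') Σ'≡m ⟩
    total c + double (e , false)                  ∎)
    where
    open ≡-Reasoning
    regroup : ∀ m e e' → m + suc (e + e') ≡ m + e + suc e'
    regroup = solve-∀

  spread-parameter-unique : ∀ {m} c c' p p' → total c + double p ≡ m → total c' + double p' ≡ m →
                            total (spread p c) ≡ total (spread p' c') → p ≡ p'
  spread-parameter-unique c c' (e , false) (e' , false) refl Σ'≡m S≡S' =
    cong (_, false) (ℕP.+-cancelˡ-≡ _ e e' (begin
      total c + double (e , false) + e    ≡⟨ total-spread-false e c ⟨
      total (spread (e , false) c)        ≡⟨ S≡S' ⟩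
      total (spread (e' , false) c')      ≡⟨ total-spread-false e' c' ⟩
      total c' + double (e' , false) + e' ≡⟨ cong (_+ e') Σ'≡m ⟩
      total c + double (e , false) + e'   ∎))
    where open ≡-Reasoning
  spread-parameter-unique c c' (e , true) (e' , true) refl Σ'≡m S≡S' =
    cong (_, true) (ℕP.suc-injective (ℕP.+-cancelˡ-≡ _ (suc e) (suc e') (begin
      total (spread (e , true) c) + suc e    ≡⟨ total-spread-true e c ⟩
      total c + double (e , true)            ≡⟨ trans (total-spread-true e' c') Σ'≡m ⟨
      total (spread (e' , true) c') + suc e' ≡⟨ cong (_+ suc e') S≡S' ⟨
      total (spread (e , true) c) + suc e'   ∎)))
    where open ≡-Reasoning
  spread-parameter-unique c c' (e , false) (e' , true) Σ≡m Σ'≡m S≡S' =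
    ⊥-elim (even-odd-clash c c' e e' Σ≡m Σ'≡m S≡S')
  spread-parameter-unique c c' (e , true) (e' , false) Σ≡m Σ'≡m S≡S' =
    ⊥-elim (even-odd-clash c' c e' e Σ'≡m Σ≡m (sym S≡S'))

  spread-injective : ∀ {m} c c' p p' → total c + double p ≡ m → total c' + double p' ≡ m →
                     spread p c ≡ spread p' c' → c ≡ c' × p ≡ p'
  spread-injective c c' p p' Σ≡m Σ'≡m eq
    with refl ← spread-parameter-unique c c' p p' Σ≡m Σ'≡m (cong total eq) =
    trans (sym (unspread-spread p c)) (trans (cong (unspread p) eq) (unspread-spread p c')) , refl

  fromComposition : ℕ × ℕ × ℕ × ℕ × ℕ → Point
  fromComposition (a , u , v , w , k) = spread (halve k) (a , u , v , w)

  fromComposition-image : ∀ m x → Image fromComposition (Composition m) x ⇔ Admissible m x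
  fromComposition-image m x = mk⇔ to from
    where
    to : Image fromComposition (Composition m) x → Admissible m x
    to ((a , u , v , w , k) , refl , refl) =
      subst (λ n → Admissible n (spread (halve k) (a , u , v , w)))
            (cong (a + u + v + w +_) (double-halve k))
            (spread-admissible (a , u , v , w) (halve k))
    from : Admissible m x → Image fromComposition (Composition m) x
    from admissible with (a , u , v , w) , p , Σ≡m , refl ← admissible⇒spread x admissible =
      (a , u , v , w , double p) , Σ≡m , cong (λ p → spread p (a , u , v , w)) (halve-double p)

  fromComposition-injective : ∀ {m} c c' → Composition m c → Composition m c' →
                              fromComposition c ≡ fromComposition c' → c ≡ c'
  fromComposition-injective (a , u , v , w , k) (a' , u' , v' , w' , k') Σ≡m Σ'≡m eq
    with refl , halve-k≡halve-k' ←
         spread-injective (a , u , v , w) (a' , u' , v' , w') (halve k) (halve k')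
           (trans (cong (a + u + v + w +_) (double-halve k)) Σ≡m)
           (trans (cong (a' + u' + v' + w' +_) (double-halve k')) Σ'≡m)
           eq =
    cong (λ k → a , u , v , w , k) (trans (sym (double-halve k)) (trans (cong double halve-k≡halve-k') (double-halve k')))

  admissible-enumerates : ∀ m → Enumerates (Admissible m) (map fromComposition (quintuples m))
  admissible-enumerates m =
    enumerates-⇔ (fromComposition-image m)
      (enumerates-image fromComposition (λ {c} {c'} → fromComposition-injective c c') (quintuples-enumerates m))

module Tallies where

  open import Data.Nat using (zero; _+_; _∸_; _⊓_; _<ᵇ_)
  open import Data.Vec using ([]; _∷_; tabulate)
  open AdmissiblePoints using (total)

  Tally : Set
  Tally = ℕ × ℕ × ℕ × ℕ

  -- tally b c records one more position, lying in y iff b and in z iff c; the four entries count the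
  -- positions in y ∩ z, y ─ z, z ─ y and outside y ∪ z.
  tally : Bool → Bool → Tally → Tally
  tally true  true  (a , b , c , d) = suc a , b , c , d
  tally true  false (a , b , c , d) = a , suc b , c , d
  tally false true  (a , b , c , d) = a , b , suc c , d
  tally false false (a , b , c , d) = a , b , c , suc d

  tallies : ∀ {n} → Subset n → Subset n → Subset n → Tally × Tally
  tallies []          []      []      = (0 , 0 , 0 , 0) , (0 , 0 , 0 , 0)
  tallies (true  ∷ x) (b ∷ y) (c ∷ z) = map₁ (tally b c) (tallies x y z)
  tallies (false ∷ x) (b ∷ y) (c ∷ z) = map₂ (tally b c) (tallies x y z)

  inside outside : ∀ {n} → Subset n → Subset n → Subset n → Tally
  inside  x y z = proj₁ (tallies x y z)
  outside x y z = proj₂ (tallies x y z)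

  inY inZ inYZ : Tally → ℕ
  inY  (a , b , _ , _) = a + b
  inZ  (a , _ , c , _) = a + c
  inYZ (a , _ , _ , _) = a

  inY-tally : ∀ c T → inY (tally true c T) ≡ suc (inY T)
  inY-tally true  _             = refl
  inY-tally false (a , b , _ , _) = ℕP.+-suc a b

  inZ-tally : ∀ b T → inZ (tally b true T) ≡ suc (inZ T)
  inZ-tally true  _             = refl
  inZ-tally false (a , _ , c , _) = ℕP.+-suc a c

  ∣x∩y∣≡ : ∀ {n} (x y z : Subset n) → Subset.∣ x ∩ y ∣ ≡ inY (inside x y z)
  ∣x∩y∣≡ []          []          []          = refl
  ∣x∩y∣≡ (true  ∷ x) (true  ∷ y) (true  ∷ z) = cong suc (∣x∩y∣≡ x y z)
  ∣x∩y∣≡ (true  ∷ x) (true  ∷ y) (false ∷ z) = trans (cong suc (∣x∩y∣≡ x y z)) (sym (ℕP.+-suc _ _))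
  ∣x∩y∣≡ (true  ∷ x) (false ∷ y) (true  ∷ z) = ∣x∩y∣≡ x y z
  ∣x∩y∣≡ (true  ∷ x) (false ∷ y) (false ∷ z) = ∣x∩y∣≡ x y z
  ∣x∩y∣≡ (false ∷ x) (_     ∷ y) (_     ∷ z) = ∣x∩y∣≡ x y z

  ∣x∩z∣≡ : ∀ {n} (x y z : Subset n) → Subset.∣ x ∩ z ∣ ≡ inZ (inside x y z)
  ∣x∩z∣≡ []          []          []          = refl
  ∣x∩z∣≡ (true  ∷ x) (true  ∷ y) (true  ∷ z) = cong suc (∣x∩z∣≡ x y z)
  ∣x∩z∣≡ (true  ∷ x) (false ∷ y) (true  ∷ z) = trans (cong suc (∣x∩z∣≡ x y z)) (sym (ℕP.+-suc _ _))
  ∣x∩z∣≡ (true  ∷ x) (true  ∷ y) (false ∷ z) = ∣x∩z∣≡ x y z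
  ∣x∩z∣≡ (true  ∷ x) (false ∷ y) (false ∷ z) = ∣x∩z∣≡ x y z
  ∣x∩z∣≡ (false ∷ x) (_     ∷ y) (_     ∷ z) = ∣x∩z∣≡ x y z

  ∣x∩y∩z∣≡ : ∀ {n} (x y z : Subset n) → Subset.∣ x ∩ y ∩ z ∣ ≡ inYZ (inside x y z)
  ∣x∩y∩z∣≡ []          []          []          = refl
  ∣x∩y∩z∣≡ (true  ∷ x) (true  ∷ y) (true  ∷ z) = cong suc (∣x∩y∩z∣≡ x y z)
  ∣x∩y∩z∣≡ (true  ∷ x) (true  ∷ y) (false ∷ z) = ∣x∩y∩z∣≡ x y z
  ∣x∩y∩z∣≡ (true  ∷ x) (false ∷ y) (true  ∷ z) = ∣x∩y∩z∣≡ x y z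
  ∣x∩y∩z∣≡ (true  ∷ x) (false ∷ y) (false ∷ z) = ∣x∩y∩z∣≡ x y z
  ∣x∩y∩z∣≡ (false ∷ x) (_     ∷ y) (_     ∷ z) = ∣x∩y∩z∣≡ x y z

  ∣y∩z∣≡ : ∀ {n} (x y z : Subset n) → Subset.∣ y ∩ z ∣ ≡ inYZ (inside x y z) + inYZ (outside x y z)
  ∣y∩z∣≡ []          []          []          = refl
  ∣y∩z∣≡ (true  ∷ x) (true  ∷ y) (true  ∷ z) = cong suc (∣y∩z∣≡ x y z)
  ∣y∩z∣≡ (false ∷ x) (true  ∷ y) (true  ∷ z) = trans (cong suc (∣y∩z∣≡ x y z)) (sym (ℕP.+-suc _ _))
  ∣y∩z∣≡ (true  ∷ x) (true  ∷ y) (false ∷ z) = ∣y∩z∣≡ x y z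
  ∣y∩z∣≡ (true  ∷ x) (false ∷ y) (true  ∷ z) = ∣y∩z∣≡ x y z
  ∣y∩z∣≡ (true  ∷ x) (false ∷ y) (false ∷ z) = ∣y∩z∣≡ x y z
  ∣y∩z∣≡ (false ∷ x) (true  ∷ y) (false ∷ z) = ∣y∩z∣≡ x y z
  ∣y∩z∣≡ (false ∷ x) (false ∷ y) (true  ∷ z) = ∣y∩z∣≡ x y z
  ∣y∩z∣≡ (false ∷ x) (false ∷ y) (false ∷ z) = ∣y∩z∣≡ x y z

  ∣y∣≡ : ∀ {n} (x y z : Subset n) → Subset.∣ y ∣ ≡ inY (inside x y z) + inY (outside x y z)
  ∣y∣≡ []          []          []          = refl
  ∣y∣≡ (true  ∷ x) (true  ∷ y) (true  ∷ z) = cong suc (∣y∣≡ x y z)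
  ∣y∣≡ (true  ∷ x) (true  ∷ y) (false ∷ z) =
    trans (cong suc (∣y∣≡ x y z)) (sym (cong (_+ inY (outside x y z)) (inY-tally false (inside x y z))))
  ∣y∣≡ (false ∷ x) (true  ∷ y) (true  ∷ z) =
    trans (cong suc (∣y∣≡ x y z)) (sym (ℕP.+-suc (inY (inside x y z)) (inY (outside x y z))))
  ∣y∣≡ (false ∷ x) (true  ∷ y) (false ∷ z) =
    trans (cong suc (∣y∣≡ x y z))
          (sym (trans (cong (inY (inside x y z) +_) (inY-tally false (outside x y z)))
                      (ℕP.+-suc (inY (inside x y z)) (inY (outside x y z)))))
  ∣y∣≡ (true  ∷ x) (false ∷ y) (true  ∷ z) = ∣y∣≡ x y z
  ∣y∣≡ (true  ∷ x) (false ∷ y) (false ∷ z) = ∣y∣≡ x y z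
  ∣y∣≡ (false ∷ x) (false ∷ y) (true  ∷ z) = ∣y∣≡ x y z
  ∣y∣≡ (false ∷ x) (false ∷ y) (false ∷ z) = ∣y∣≡ x y z

  ∣z∣≡ : ∀ {n} (x y z : Subset n) → Subset.∣ z ∣ ≡ inZ (inside x y z) + inZ (outside x y z)
  ∣z∣≡ []          []          []          = refl
  ∣z∣≡ (true  ∷ x) (true  ∷ y) (true  ∷ z) = cong suc (∣z∣≡ x y z)
  ∣z∣≡ (true  ∷ x) (false ∷ y) (true  ∷ z) =
    trans (cong suc (∣z∣≡ x y z)) (sym (cong (_+ inZ (outside x y z)) (inZ-tally false (inside x y z))))
  ∣z∣≡ (false ∷ x) (true  ∷ y) (true  ∷ z) =
    trans (cong suc (∣z∣≡ x y z)) (sym (ℕP.+-suc (inZ (inside x y z)) (inZ (outside x y z))))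
  ∣z∣≡ (false ∷ x) (false ∷ y) (true  ∷ z) =
    trans (cong suc (∣z∣≡ x y z))
          (sym (trans (cong (inZ (inside x y z) +_) (inZ-tally false (outside x y z)))
                      (ℕP.+-suc (inZ (inside x y z)) (inZ (outside x y z)))))
  ∣z∣≡ (true  ∷ x) (true  ∷ y) (false ∷ z) = ∣z∣≡ x y z
  ∣z∣≡ (true  ∷ x) (false ∷ y) (false ∷ z) = ∣z∣≡ x y z
  ∣z∣≡ (false ∷ x) (true  ∷ y) (false ∷ z) = ∣z∣≡ x y z
  ∣z∣≡ (false ∷ x) (false ∷ y) (false ∷ z) = ∣z∣≡ x y z

  total-tally : ∀ b c T → total (tally b c T) ≡ suc (total T)
  total-tally true  true  _               = refl
  total-tally true  false (a , b , c , d) = cong (λ s → s + c + d) (ℕP.+-suc a b)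
  total-tally false true  (a , b , c , d) = cong (_+ d) (ℕP.+-suc (a + b) c)
  total-tally false false (a , b , c , d) = ℕP.+-suc (a + b + c) d

  ∣x∣≡ : ∀ {n} (x y z : Subset n) → Subset.∣ x ∣ ≡ total (inside x y z)
  ∣x∣≡ []          []      []      = refl
  ∣x∣≡ (true  ∷ x) (b ∷ y) (c ∷ z) = trans (cong suc (∣x∣≡ x y z)) (sym (total-tally b c _))
  ∣x∣≡ (false ∷ x) (_ ∷ y) (_ ∷ z) = ∣x∣≡ x y z

  ∣∁x∣≡ : ∀ {n} (x y z : Subset n) → Subset.∣ ∁ x ∣ ≡ total (outside x y z)
  ∣∁x∣≡ []          []      []      = refl
  ∣∁x∣≡ (true  ∷ x) (_ ∷ y) (_ ∷ z) = ∣∁x∣≡ x y z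
  ∣∁x∣≡ (false ∷ x) (b ∷ y) (c ∷ z) = trans (cong suc (∣∁x∣≡ x y z)) (sym (total-tally b c _))

  untally : ∀ T {k} → total T ≡ suc k → ∃[ b ] ∃[ c ] ∃[ T' ] (total T' ≡ k × tally b c T' ≡ T)
  untally (suc a , b , c , d) eq = true  , true  , (a , b , c , d) , ℕP.suc-injective eq , refl
  untally (0 , suc b , c , d) eq = true  , false , (0 , b , c , d) , ℕP.suc-injective eq , refl
  untally (0 , 0 , suc c , d) eq = false , true  , (0 , 0 , c , d) , ℕP.suc-injective eq , refl
  untally (0 , 0 , 0 , suc d) eq = false , false , (0 , 0 , 0 , d) , ℕP.suc-injective eq , refl

  total≡0 : ∀ T → total T ≡ 0 → T ≡ (0 , 0 , 0 , 0)
  total≡0 (0 , 0 , 0 , 0) _ = refl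

  tallies-surjective : ∀ {n} (x : Subset n) I O → total I ≡ Subset.∣ x ∣ → total O ≡ Subset.∣ ∁ x ∣ →
                       ∃[ y ] ∃[ z ] tallies x y z ≡ (I , O)
  tallies-surjective []          I O ΣI≡0 ΣO≡0 = [] , [] , sym (cong₂ _,_ (total≡0 I ΣI≡0) (total≡0 O ΣO≡0))
  tallies-surjective (true  ∷ x) I O ΣI≡ ΣO≡
    with b , c , I' , ΣI'≡ , refl ← untally I ΣI≡
    with y , z , eq ← tallies-surjective x I' O ΣI'≡ ΣO≡ = b ∷ y , c ∷ z , cong (map₁ (tally b c)) eq
  tallies-surjective (false ∷ x) I O ΣI≡ ΣO≡
    with b , c , O' , ΣO'≡ , refl ← untally O ΣO≡
    with y , z , eq ← tallies-surjective x I O' ΣI≡ ΣO'≡ = b ∷ y , c ∷ z , cong (map₂ (tally b c)) eq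

  ∣x₀∣≡m : ∀ m → Subset.∣ x₀ m ∣ ≡ m
  ∣x₀∣≡m m = trans (∣prefix∣ (suc (m + m)) m) (ℕP.m≥n⇒m⊓n≡n (ℕP.≤-trans (ℕP.m≤m+n m m) (ℕP.n≤1+n _)))
    where
    ∣prefix∣ : ∀ k m → Subset.∣ tabulate {n = k} (λ i → toℕ i <ᵇ m) ∣ ≡ k ⊓ m
    ∣prefix∣ zero    m       = refl
    ∣prefix∣ (suc k) zero    = trans (∣prefix∣ k zero) (ℕP.⊓-zeroʳ k)
    ∣prefix∣ (suc k) (suc m) = cong suc (∣prefix∣ k m)

  ∣∁x₀∣≡1+m : ∀ m → Subset.∣ ∁ (x₀ m) ∣ ≡ suc m
  ∣∁x₀∣≡1+m m =
    trans (∣∁p∣≡n∸∣p∣ (x₀ m)) (trans (cong (suc (m + m) ∸_) (∣x₀∣≡m m)) (ℕP.m+n∸n≡m (suc m) m))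

open Compositions using (quintuples; length-quintuples)
open AdmissiblePoints
open Tallies

open import Data.Integer using (ℤ; +_; -_; _+_; _-_; _⊔_; _⊓_; 0ℤ; +≤+; ∣_∣) renaming (_≤_ to _≤ℤ_)
import Data.Integer as ℤ
import Data.Integer.Properties as ℤP
open import Data.Integer.Tactic.RingSolver using (solve; solve-∀)

private variable
  a b c d e i j k : ℤ

≤-byDifference : ∀ e → 0ℤ ≤ℤ e → j - i ≡ e → i ≤ℤ j
≤-byDifference e 0≤e eq = ℤP.0≤i-j⇒j≤i (subst (0ℤ ≤ℤ_) (sym eq) 0≤e)

0≤-byDifference : i ≤ℤ j → j - i ≡ e → 0ℤ ≤ℤ e
0≤-byDifference i≤j eq = subst (0ℤ ≤ℤ_) eq (ℤP.i≤j⇒0≤j-i i≤j)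

0≤+ : 0ℤ ≤ℤ i → 0ℤ ≤ℤ j → 0ℤ ≤ℤ i + j
0≤+ = ℤP.+-mono-≤

i-j≤k⇒i-k≤j : i - j ≤ℤ k → i - k ≤ℤ j
i-j≤k⇒i-k≤j {i} {j} {k} h = ≤-byDifference _ (ℤP.i≤j⇒0≤j-i h) (solve (i ∷ j ∷ k ∷ []))

i≤j-k⇒k≤j-i : i ≤ℤ j - k → k ≤ℤ j - i
i≤j-k⇒k≤j-i {i} {j} {k} h = ≤-byDifference _ (ℤP.i≤j⇒0≤j-i h) (solve (i ∷ j ∷ k ∷ []))

i+j≤k⇒j≤k-i : i + j ≤ℤ k → j ≤ℤ k - i
i+j≤k⇒j≤k-i {i} {j} {k} h = ≤-byDifference _ (ℤP.i≤j⇒0≤j-i h) (solve (i ∷ j ∷ k ∷ []))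

j≤k-i⇒i+j≤k : j ≤ℤ k - i → i + j ≤ℤ k
j≤k-i⇒i+j≤k {j} {k} {i} h = ≤-byDifference _ (ℤP.i≤j⇒0≤j-i h) (solve (i ∷ j ∷ k ∷ []))

k≤i+j⇒k-i≤j : k ≤ℤ i + j → k - i ≤ℤ j
k≤i+j⇒k-i≤j {k} {i} {j} h = ≤-byDifference _ (ℤP.i≤j⇒0≤j-i h) (solve (i ∷ j ∷ k ∷ []))

k-i≤j⇒k≤i+j : k - i ≤ℤ j → k ≤ℤ i + j
k-i≤j⇒k≤i+j {k} {i} {j} h = ≤-byDifference _ (ℤP.i≤j⇒0≤j-i h) (solve (i ∷ j ∷ k ∷ []))

absℤ-≤ : ∀ i → i ≤ℤ j → - i ≤ℤ j → absℤ i ≤ℤ j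
absℤ-≤ (+ _)       i≤j _    = i≤j
absℤ-≤ ℤ.-[1+ _ ] _   -i≤j = -i≤j

⊔-≤⁺ : a ≤ℤ k → b ≤ℤ k → a ⊔ b ≤ℤ k
⊔-≤⁺ = ℤP.⊔-lub

⊔₄-≤⁺ : a ≤ℤ k → b ≤ℤ k → c ≤ℤ k → d ≤ℤ k → a ⊔ b ⊔ c ⊔ d ≤ℤ k
⊔₄-≤⁺ a≤k b≤k c≤k d≤k = ℤP.⊔-lub (ℤP.⊔-lub (ℤP.⊔-lub a≤k b≤k) c≤k) d≤k

⊔₄-≤⁻ : a ⊔ b ⊔ c ⊔ d ≤ℤ k → a ≤ℤ k × b ≤ℤ k × c ≤ℤ k × d ≤ℤ k
⊔₄-≤⁻ {a} {b} {c} {d} h =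
  ℤP.i⊔j≤k⇒i≤k a b (ℤP.i⊔j≤k⇒i≤k (a ⊔ b) c (ℤP.i⊔j≤k⇒i≤k (a ⊔ b ⊔ c) d h)) ,
  ℤP.i⊔j≤k⇒j≤k a b (ℤP.i⊔j≤k⇒i≤k (a ⊔ b) c (ℤP.i⊔j≤k⇒i≤k (a ⊔ b ⊔ c) d h)) ,
  ℤP.i⊔j≤k⇒j≤k (a ⊔ b) c (ℤP.i⊔j≤k⇒i≤k (a ⊔ b ⊔ c) d h) ,
  ℤP.i⊔j≤k⇒j≤k (a ⊔ b ⊔ c) d h

≤-⊓₄⁺ : k ≤ℤ a → k ≤ℤ b → k ≤ℤ c → k ≤ℤ d → k ≤ℤ a ⊓ b ⊓ c ⊓ d
≤-⊓₄⁺ k≤a k≤b k≤c k≤d = ℤP.⊓-glb (ℤP.⊓-glb (ℤP.⊓-glb k≤a k≤b) k≤c) k≤d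

≤-⊓₄⁻ : k ≤ℤ a ⊓ b ⊓ c ⊓ d → k ≤ℤ a × k ≤ℤ b × k ≤ℤ c × k ≤ℤ d
≤-⊓₄⁻ {a = a} {b} {c} {d} h =
  ℤP.i≤j⊓k⇒i≤j a b (ℤP.i≤j⊓k⇒i≤j (a ⊓ b) c (ℤP.i≤j⊓k⇒i≤j (a ⊓ b ⊓ c) d h)) ,
  ℤP.i≤j⊓k⇒i≤k a b (ℤP.i≤j⊓k⇒i≤j (a ⊓ b) c (ℤP.i≤j⊓k⇒i≤j (a ⊓ b ⊓ c) d h)) ,
  ℤP.i≤j⊓k⇒i≤k (a ⊓ b) c (ℤP.i≤j⊓k⇒i≤j (a ⊓ b ⊓ c) d h) ,
  ℤP.i≤j⊓k⇒i≤k (a ⊓ b ⊓ c) d h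

-- For ρ(y,z) = (i,j,t,p), |x₀| = M, |y| = A and |z| = B these are the sizes of x₀∩y∩z, x₀∩y─z,
-- x₀∩z─y, x₀─(y∪z) and of the corresponding four cells outside x₀.
NonNegativeCells : ℤ → ℤ → ℤ → Quad → Set
NonNegativeCells M A B (i , j , t , p) =
  0ℤ ≤ℤ p × 0ℤ ≤ℤ i - p × 0ℤ ≤ℤ j - p × 0ℤ ≤ℤ M - i - j + p
  × 0ℤ ≤ℤ t - p × 0ℤ ≤ℤ A - i - t + p × 0ℤ ≤ℤ B - j - t + p × 0ℤ ≤ℤ M + + 1 - A - B + i + j + t - p

cells-cong : ∀ {M M' A A' B B' q q'} → M ≡ M' → A ≡ A' → B ≡ B' → q ≡ q' →
             NonNegativeCells M A B q → NonNegativeCells M' A' B' q'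
cells-cong refl refl refl refl cells = cells

embed : Point → Quad
embed (a , u , v , w) = + (a ℕ.+ u) , + (a ℕ.+ v) , + (a ℕ.+ w) , + a

embed-injective : ∀ {x y} → embed x ≡ embed y → x ≡ y
embed-injective {a , u , v , w} {a' , u' , v' , w'} eq =
  ≡-quadruple a≡a' (cancel (cong (λ (i , _ , _ , _) → i) eq)) (cancel (cong (λ (_ , j , _ , _) → j) eq))
              (cancel (cong (λ (_ , _ , t , _) → t) eq))
  where
  a≡a' : a ≡ a'
  a≡a' = ℤP.+-injective (cong (λ (_ , _ , _ , p) → p) eq)
  cancel : ∀ {u u'} → + (a ℕ.+ u) ≡ + (a' ℕ.+ u') → u ≡ u'
  cancel {u} {u'} eq = ℕP.+-cancelˡ-≡ a u u' (trans (ℤP.+-injective eq) (cong (ℕ._+ u') (sym a≡a')))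

p+[i-p]≡i : ∀ p i → p + (i - p) ≡ i
p+[i-p]≡i = solve-∀

coordinates : ∀ {i j t p} → 0ℤ ≤ℤ p → 0ℤ ≤ℤ i - p → 0ℤ ≤ℤ j - p → 0ℤ ≤ℤ t - p →
              embed (∣ p ∣ , ∣ i - p ∣ , ∣ j - p ∣ , ∣ t - p ∣) ≡ (i , j , t , p)
coordinates {i} {j} {t} {p} 0≤p 0≤i-p 0≤j-p 0≤t-p =
  ≡-quadruple (coordinate 0≤i-p) (coordinate 0≤j-p) (coordinate 0≤t-p) (ℤP.0≤i⇒+∣i∣≡i 0≤p)
  where
  coordinate : ∀ {i} → 0ℤ ≤ℤ i - p → + ∣ p ∣ + + ∣ i - p ∣ ≡ i
  coordinate {i} 0≤i-p = trans (cong₂ _+_ (ℤP.0≤i⇒+∣i∣≡i 0≤p) (ℤP.0≤i⇒+∣i∣≡i 0≤i-p)) (p+[i-p]≡i p i)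

ρ-of : Tally × Tally → Quad
ρ-of ((a , b , c , _) , (e , _ , _ , _)) = embed (a , b , c , e)

ρ-tallies : ∀ m y z → ρ m y z ≡ ρ-of (tallies (x₀ m) y z)
ρ-tallies m y z =
  ≡-quadruple (cong +_ (∣x∩y∣≡ (x₀ m) y z)) (cong +_ (∣x∩z∣≡ (x₀ m) y z))
              (cong +_ (∣y∩z∣≡ (x₀ m) y z)) (cong +_ (∣x∩y∩z∣≡ (x₀ m) y z))

cells-of-tallies : ∀ {A B C D E F G H} → 0ℤ ≤ℤ A → 0ℤ ≤ℤ B → 0ℤ ≤ℤ C → 0ℤ ≤ℤ D →
                   0ℤ ≤ℤ E → 0ℤ ≤ℤ F → 0ℤ ≤ℤ G → 0ℤ ≤ℤ H → E + F + G + H ≡ + 1 + (A + B + C + D) →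
                   NonNegativeCells (A + B + C + D) (A + B + (E + F)) (A + C + (E + G)) (A + B , A + C , A + E , A)
cells-of-tallies {A} {B} {C} {D} {E} {F} {G} {H} 0≤A 0≤B 0≤C 0≤D 0≤E 0≤F 0≤G 0≤H outside≡1+inside =
  0≤A
  , 0≤-byDifference 0≤B (solve (A ∷ B ∷ []))
  , 0≤-byDifference 0≤C (solve (A ∷ C ∷ []))
  , 0≤-byDifference 0≤D (solve (A ∷ B ∷ C ∷ D ∷ []))
  , 0≤-byDifference 0≤E (solve (A ∷ E ∷ []))
  , 0≤-byDifference 0≤F (solve (A ∷ B ∷ E ∷ F ∷ []))
  , 0≤-byDifference 0≤G (solve (A ∷ C ∷ E ∷ G ∷ []))
  , 0≤-byDifference 0≤H (begin
      H - 0ℤ                              ≡⟨ solve (E ∷ F ∷ G ∷ H ∷ []) ⟩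
      E + F + G + H - E - F - G           ≡⟨ cong (λ s → s - E - F - G) outside≡1+inside ⟩
      + 1 + (A + B + C + D) - E - F - G   ≡⟨ solve (A ∷ B ∷ C ∷ D ∷ E ∷ F ∷ G ∷ []) ⟩
      A + B + C + D + + 1 - (A + B + (E + F)) - (A + C + (E + G)) + (A + B) + (A + C) + (A + E) - A ∎)
  where open ≡-Reasoning

tallies-cells : ∀ T → total (proj₂ T) ≡ suc (total (proj₁ T)) →
                let I , O = T in NonNegativeCells (+ total I) (+ (inY I ℕ.+ inY O)) (+ (inZ I ℕ.+ inZ O)) (ρ-of T)
tallies-cells ((A , B , C , D) , (E , F , G , H)) outside≡1+inside =
  cells-of-tallies 0≤ℕ 0≤ℕ 0≤ℕ 0≤ℕ 0≤ℕ 0≤ℕ 0≤ℕ 0≤ℕ (cong +_ outside≡1+inside)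
  where
  0≤ℕ : ∀ {n} → 0ℤ ≤ℤ + n
  0≤ℕ = +≤+ ℕ.z≤n

In𝓘⇒cells : ∀ m a b q → In𝓘 m a b q → NonNegativeCells (+ m) (+ a) (+ b) q
In𝓘⇒cells m a b q (y , z , ∣y∣≡a , ∣z∣≡b , refl) =
  cells-cong (cong +_ ∣inside∣≡m) (cong +_ (trans (sym (∣y∣≡ (x₀ m) y z)) ∣y∣≡a))
             (cong +_ (trans (sym (∣z∣≡ (x₀ m) y z)) ∣z∣≡b))
             (sym (ρ-tallies m y z)) (tallies-cells (tallies (x₀ m) y z) ∣outside∣≡1+∣inside∣)
  where
  ∣inside∣≡m : total (inside (x₀ m) y z) ≡ m
  ∣inside∣≡m = trans (sym (∣x∣≡ (x₀ m) y z)) (∣x₀∣≡m m)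
  ∣outside∣≡1+∣inside∣ : total (outside (x₀ m) y z) ≡ suc (total (inside (x₀ m) y z))
  ∣outside∣≡1+∣inside∣ =
    trans (sym (∣∁x∣≡ (x₀ m) y z)) (trans (∣∁x₀∣≡1+m m) (cong suc (sym ∣inside∣≡m)))

cells-inside-sum : ∀ M i j p → p + (i - p) + (j - p) + (M - i - j + p) ≡ M
cells-inside-sum = solve-∀

cells-outside-sum : ∀ M A B i j t p →
                    t - p + (A - i - t + p) + (B - j - t + p) + (M + + 1 - A - B + i + j + t - p) ≡ + 1 + M
cells-outside-sum = solve-∀

cells-in-y-sum : ∀ A i t p → p + (i - p) + (t - p + (A - i - t + p)) ≡ A
cells-in-y-sum = solve-∀

cells⇒In𝓘 : ∀ m a b i j t p → NonNegativeCells (+ m) (+ a) (+ b) (i , j , t , p) → In𝓘 m a b (i , j , t , p)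
cells⇒In𝓘 m a b i j t p (c₁ , c₂ , c₃ , c₄ , c₅ , c₆ , c₇ , c₈) =
  let y , z , tallies≡ = tallies-surjective (x₀ m) I O (trans ∣I∣≡m (sym (∣x₀∣≡m m)))
                                                       (trans ∣O∣≡1+m (sym (∣∁x₀∣≡1+m m)))
  in y , z , ∣y∣≡a tallies≡ , ∣z∣≡b tallies≡
     , trans (ρ-tallies m y z) (trans (cong ρ-of tallies≡) (coordinates c₁ c₂ c₃ c₅))
  where
  open ≡-Reasoning
  n : ∀ {x} → 0ℤ ≤ℤ x → + ∣ x ∣ ≡ x
  n = ℤP.0≤i⇒+∣i∣≡i
  I O : Tally
  I = ∣ p ∣ , ∣ i - p ∣ , ∣ j - p ∣ , ∣ + m - i - j + p ∣
  O = ∣ t - p ∣ , ∣ + a - i - t + p ∣ , ∣ + b - j - t + p ∣ , ∣ + m + + 1 - + a - + b + i + j + t - p ∣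
  ∣I∣≡m : total I ≡ m
  ∣I∣≡m = ℤP.+-injective (trans (cong₂ _+_ (cong₂ _+_ (cong₂ _+_ (n c₁) (n c₂)) (n c₃)) (n c₄))
                               (cells-inside-sum (+ m) i j p))
  ∣O∣≡1+m : total O ≡ suc m
  ∣O∣≡1+m = ℤP.+-injective (trans (cong₂ _+_ (cong₂ _+_ (cong₂ _+_ (n c₅) (n c₆)) (n c₇)) (n c₈))
                                 (cells-outside-sum (+ m) (+ a) (+ b) i j t p))
  ∣y∣≡a : ∀ {y z} → tallies (x₀ m) y z ≡ (I , O) → Subset.∣ y ∣ ≡ a
  ∣y∣≡a {y} {z} tallies≡ = ℤP.+-injective (begin
    + Subset.∣ y ∣
      ≡⟨ cong +_ (trans (∣y∣≡ (x₀ m) y z) (cong (λ (I , O) → inY I ℕ.+ inY O) tallies≡)) ⟩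
    + inY I + + inY O                         ≡⟨ cong₂ _+_ (cong₂ _+_ (n c₁) (n c₂)) (cong₂ _+_ (n c₅) (n c₆)) ⟩
    p + (i - p) + (t - p + (+ a - i - t + p)) ≡⟨ cells-in-y-sum (+ a) i t p ⟩
    + a                                       ∎)
  ∣z∣≡b : ∀ {y z} → tallies (x₀ m) y z ≡ (I , O) → Subset.∣ z ∣ ≡ b
  ∣z∣≡b {y} {z} tallies≡ = ℤP.+-injective (begin
    + Subset.∣ z ∣
      ≡⟨ cong +_ (trans (∣z∣≡ (x₀ m) y z) (cong (λ (I , O) → inZ I ℕ.+ inZ O) tallies≡)) ⟩
    + inZ I + + inZ O                         ≡⟨ cong₂ _+_ (cong₂ _+_ (n c₁) (n c₃)) (cong₂ _+_ (n c₅) (n c₇)) ⟩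
    p + (j - p) + (t - p + (+ b - j - t + p)) ≡⟨ cells-in-y-sum (+ b) j t p ⟩
    + b                                       ∎)

In𝓘⇔cells : ∀ m a b q → In𝓘 m a b q ⇔ NonNegativeCells (+ m) (+ a) (+ b) q
In𝓘⇔cells m a b q@(i , j , t , p) = mk⇔ (In𝓘⇒cells m a b q) (cells⇒In𝓘 m a b i j t p)

-- The conditions (i)-(iv) with + m generalised to an integer M, so that the ring solver can treat M as a variable.
Cond-mmᶻ Cond-mm1ᶻ Cond-m1mᶻ Cond-m1m1ᶻ : ℤ → Quad → Set
Cond-mmᶻ M (i , j , t , p) =
  (+ 0 ≤ i ≤ M) × (+ 0 ≤ j ≤ M)
  × (((i + j - M) ⊔ (M - + 1 - i - j)) ≤ t ≤ (M - absℤ (i - j)))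
  × ((+ 0 ⊔ (i + j - M) ⊔ (i + t - M) ⊔ (j + t - M)) ≤ p ≤ (i ⊓ j ⊓ t ⊓ (i + j + t + + 1 - M)))
Cond-mm1ᶻ M (i , j , t , p) =
  (+ 0 ≤ i ≤ M) × (+ 0 ≤ j ≤ M)
  × (absℤ (i + j - M) ≤ t ≤ (M - ((i - j) ⊔ (j - i - + 1))))
  × ((i - (i ⊓ (M - j) ⊓ (M - t) ⊓ (i - j - t + M + + 1))) ≤ p ≤ (i - (+ 0 ⊔ (i - j) ⊔ (i - t) ⊔ (M - j - t))))
Cond-m1mᶻ M (i , j , t , p) =
  (+ 0 ≤ i ≤ M) × (+ 0 ≤ j ≤ M)
  × (absℤ (i + j - M) ≤ t ≤ (M - ((i - j - + 1) ⊔ (j - i))))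
  × ((j - ((M - i) ⊓ j ⊓ (M - t) ⊓ (j - i - t + M + + 1))) ≤ p ≤ (j - (+ 0 ⊔ (j - i) ⊔ (j - t) ⊔ (M - i - t))))
Cond-m1m1ᶻ M (i , j , t , p) =
  (+ 0 ≤ i ≤ M) × (+ 0 ≤ j ≤ M)
  × ((+ 1 + ((i + j - M - + 1) ⊔ (M - i - j))) ≤ t ≤ (M + + 1 - absℤ (i - j)))
  × ((i + j - M + (+ 0 ⊔ (M - i - j) ⊔ (t - i - + 1) ⊔ (t - j - + 1))) ≤ p
       ≤ (i + j - M + ((M - i) ⊓ (M - j) ⊓ (t - + 1) ⊓ (M - i - j + t))))

Cond-mmᶻ⇔cells : ∀ M i j t p → Cond-mmᶻ M (i , j , t , p) ⇔ NonNegativeCells M M M (i , j , t , p)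
Cond-mmᶻ⇔cells M i j t p = mk⇔ to from
  where
  to : Cond-mmᶻ M (i , j , t , p) → NonNegativeCells M M M (i , j , t , p)
  to (_ , _ , _ , lower , upper) with ⊔₄-≤⁻ lower | ≤-⊓₄⁻ upper
  ... | 0≤p , l₂ , l₃ , l₄ | u₁ , u₂ , u₃ , u₄ =
    0≤p , ℤP.i≤j⇒0≤j-i u₁ , ℤP.i≤j⇒0≤j-i u₂
    , 0≤-byDifference l₂ (solve (i ∷ j ∷ t ∷ p ∷ M ∷ []))
    , ℤP.i≤j⇒0≤j-i u₃
    , 0≤-byDifference l₃ (solve (i ∷ j ∷ t ∷ p ∷ M ∷ []))
    , 0≤-byDifference l₄ (solve (i ∷ j ∷ t ∷ p ∷ M ∷ []))
    , 0≤-byDifference u₄ (solve (i ∷ j ∷ t ∷ p ∷ M ∷ []))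
  from : NonNegativeCells M M M (i , j , t , p) → Cond-mmᶻ M (i , j , t , p)
  from (c₁ , c₂ , c₃ , c₄ , c₅ , c₆ , c₇ , c₈) =
    ( ≤-byDifference _ (0≤+ c₁ c₂) (solve (i ∷ j ∷ t ∷ p ∷ M ∷ []))
    , ≤-byDifference _ (0≤+ c₄ c₃) (solve (i ∷ j ∷ t ∷ p ∷ M ∷ [])) )
    , ( ≤-byDifference _ (0≤+ c₁ c₃) (solve (i ∷ j ∷ t ∷ p ∷ M ∷ []))
      , ≤-byDifference _ (0≤+ c₄ c₂) (solve (i ∷ j ∷ t ∷ p ∷ M ∷ [])) )
    , ( ⊔-≤⁺ (≤-byDifference _ (0≤+ c₄ c₅) (solve (i ∷ j ∷ t ∷ p ∷ M ∷ [])))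
             (≤-byDifference _ (0≤+ c₁ c₈) (solve (i ∷ j ∷ t ∷ p ∷ M ∷ [])))
      , i≤j-k⇒k≤j-i {j = M} (absℤ-≤ (i - j) (≤-byDifference _ (0≤+ c₆ c₃) (solve (i ∷ j ∷ t ∷ p ∷ M ∷ [])))
                                        (≤-byDifference _ (0≤+ c₇ c₂) (solve (i ∷ j ∷ t ∷ p ∷ M ∷ [])))) )
    , ( ⊔₄-≤⁺ c₁ (≤-byDifference _ c₄ (solve (i ∷ j ∷ t ∷ p ∷ M ∷ [])))
                 (≤-byDifference _ c₆ (solve (i ∷ j ∷ t ∷ p ∷ M ∷ [])))
                 (≤-byDifference _ c₇ (solve (i ∷ j ∷ t ∷ p ∷ M ∷ [])))
      , ≤-⊓₄⁺ (≤-byDifference _ c₂ (solve (i ∷ j ∷ t ∷ p ∷ M ∷ [])))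
              (≤-byDifference _ c₃ (solve (i ∷ j ∷ t ∷ p ∷ M ∷ [])))
              (≤-byDifference _ c₅ (solve (i ∷ j ∷ t ∷ p ∷ M ∷ [])))
              (≤-byDifference _ c₈ (solve (i ∷ j ∷ t ∷ p ∷ M ∷ []))) )

Cond-mm1ᶻ⇔cells : ∀ M i j t p → Cond-mm1ᶻ M (i , j , t , p) ⇔ NonNegativeCells M M (+ 1 + M) (i , j , t , p)
Cond-mm1ᶻ⇔cells M i j t p = mk⇔ to from
  where
  to : Cond-mm1ᶻ M (i , j , t , p) → NonNegativeCells M M (+ 1 + M) (i , j , t , p)
  to (_ , _ , _ , lower , upper)
    with ≤-⊓₄⁻ (i-j≤k⇒i-k≤j {i = i} lower) | ⊔₄-≤⁻ (i≤j-k⇒k≤j-i {j = i} upper)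
  ... | l₁ , l₂ , l₃ , l₄ | u₁ , u₂ , u₃ , u₄ =
    0≤-byDifference l₁ (solve (i ∷ j ∷ t ∷ p ∷ M ∷ []))
    , 0≤-byDifference u₁ (solve (i ∷ j ∷ t ∷ p ∷ M ∷ []))
    , 0≤-byDifference u₂ (solve (i ∷ j ∷ t ∷ p ∷ M ∷ []))
    , 0≤-byDifference l₂ (solve (i ∷ j ∷ t ∷ p ∷ M ∷ []))
    , 0≤-byDifference u₃ (solve (i ∷ j ∷ t ∷ p ∷ M ∷ []))
    , 0≤-byDifference l₃ (solve (i ∷ j ∷ t ∷ p ∷ M ∷ []))
    , 0≤-byDifference l₄ (solve (i ∷ j ∷ t ∷ p ∷ M ∷ []))
    , 0≤-byDifference u₄ (solve (i ∷ j ∷ t ∷ p ∷ M ∷ []))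
  from : NonNegativeCells M M (+ 1 + M) (i , j , t , p) → Cond-mm1ᶻ M (i , j , t , p)
  from (c₁ , c₂ , c₃ , c₄ , c₅ , c₆ , c₇ , c₈) =
    ( ≤-byDifference _ (0≤+ c₁ c₂) (solve (i ∷ j ∷ t ∷ p ∷ M ∷ []))
    , ≤-byDifference _ (0≤+ c₄ c₃) (solve (i ∷ j ∷ t ∷ p ∷ M ∷ [])) )
    , ( ≤-byDifference _ (0≤+ c₁ c₃) (solve (i ∷ j ∷ t ∷ p ∷ M ∷ []))
      , ≤-byDifference _ (0≤+ c₄ c₂) (solve (i ∷ j ∷ t ∷ p ∷ M ∷ [])) )
    , ( absℤ-≤ (i + j - M) (≤-byDifference _ (0≤+ c₄ c₅) (solve (i ∷ j ∷ t ∷ p ∷ M ∷ [])))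
                           (≤-byDifference _ (0≤+ c₈ c₁) (solve (i ∷ j ∷ t ∷ p ∷ M ∷ [])))
      , i≤j-k⇒k≤j-i {j = M} (⊔-≤⁺ (≤-byDifference _ (0≤+ c₆ c₃) (solve (i ∷ j ∷ t ∷ p ∷ M ∷ [])))
                                   (≤-byDifference _ (0≤+ c₇ c₂) (solve (i ∷ j ∷ t ∷ p ∷ M ∷ [])))) )
    , ( i-j≤k⇒i-k≤j {i = i} (≤-⊓₄⁺ (≤-byDifference _ c₁ (solve (i ∷ j ∷ t ∷ p ∷ M ∷ [])))
                                    (≤-byDifference _ c₄ (solve (i ∷ j ∷ t ∷ p ∷ M ∷ [])))
                                    (≤-byDifference _ c₆ (solve (i ∷ j ∷ t ∷ p ∷ M ∷ [])))
                                    (≤-byDifference _ c₇ (solve (i ∷ j ∷ t ∷ p ∷ M ∷ []))))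
      , i≤j-k⇒k≤j-i {j = i} (⊔₄-≤⁺ (≤-byDifference _ c₂ (solve (i ∷ j ∷ t ∷ p ∷ M ∷ [])))
                                    (≤-byDifference _ c₃ (solve (i ∷ j ∷ t ∷ p ∷ M ∷ [])))
                                    (≤-byDifference _ c₅ (solve (i ∷ j ∷ t ∷ p ∷ M ∷ [])))
                                    (≤-byDifference _ c₈ (solve (i ∷ j ∷ t ∷ p ∷ M ∷ [])))) )

Cond-m1mᶻ⇔cells : ∀ M i j t p → Cond-m1mᶻ M (i , j , t , p) ⇔ NonNegativeCells M (+ 1 + M) M (i , j , t , p)
Cond-m1mᶻ⇔cells M i j t p = mk⇔ to from
  where
  to : Cond-m1mᶻ M (i , j , t , p) → NonNegativeCells M (+ 1 + M) M (i , j , t , p)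
  to (_ , _ , _ , lower , upper)
    with ≤-⊓₄⁻ (i-j≤k⇒i-k≤j {i = j} lower) | ⊔₄-≤⁻ (i≤j-k⇒k≤j-i {j = j} upper)
  ... | l₁ , l₂ , l₃ , l₄ | u₁ , u₂ , u₃ , u₄ =
    0≤-byDifference l₂ (solve (i ∷ j ∷ t ∷ p ∷ M ∷ []))
    , 0≤-byDifference u₂ (solve (i ∷ j ∷ t ∷ p ∷ M ∷ []))
    , 0≤-byDifference u₁ (solve (i ∷ j ∷ t ∷ p ∷ M ∷ []))
    , 0≤-byDifference l₁ (solve (i ∷ j ∷ t ∷ p ∷ M ∷ []))
    , 0≤-byDifference u₃ (solve (i ∷ j ∷ t ∷ p ∷ M ∷ []))
    , 0≤-byDifference l₄ (solve (i ∷ j ∷ t ∷ p ∷ M ∷ []))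
    , 0≤-byDifference l₃ (solve (i ∷ j ∷ t ∷ p ∷ M ∷ []))
    , 0≤-byDifference u₄ (solve (i ∷ j ∷ t ∷ p ∷ M ∷ []))
  from : NonNegativeCells M (+ 1 + M) M (i , j , t , p) → Cond-m1mᶻ M (i , j , t , p)
  from (c₁ , c₂ , c₃ , c₄ , c₅ , c₆ , c₇ , c₈) =
    ( ≤-byDifference _ (0≤+ c₁ c₂) (solve (i ∷ j ∷ t ∷ p ∷ M ∷ []))
    , ≤-byDifference _ (0≤+ c₄ c₃) (solve (i ∷ j ∷ t ∷ p ∷ M ∷ [])) )
    , ( ≤-byDifference _ (0≤+ c₁ c₃) (solve (i ∷ j ∷ t ∷ p ∷ M ∷ []))
      , ≤-byDifference _ (0≤+ c₄ c₂) (solve (i ∷ j ∷ t ∷ p ∷ M ∷ [])) )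
    , ( absℤ-≤ (i + j - M) (≤-byDifference _ (0≤+ c₄ c₅) (solve (i ∷ j ∷ t ∷ p ∷ M ∷ [])))
                           (≤-byDifference _ (0≤+ c₈ c₁) (solve (i ∷ j ∷ t ∷ p ∷ M ∷ [])))
      , i≤j-k⇒k≤j-i {j = M} (⊔-≤⁺ (≤-byDifference _ (0≤+ c₆ c₃) (solve (i ∷ j ∷ t ∷ p ∷ M ∷ [])))
                                   (≤-byDifference _ (0≤+ c₇ c₂) (solve (i ∷ j ∷ t ∷ p ∷ M ∷ [])))) )
    , ( i-j≤k⇒i-k≤j {i = j} (≤-⊓₄⁺ (≤-byDifference _ c₄ (solve (i ∷ j ∷ t ∷ p ∷ M ∷ [])))
                                    (≤-byDifference _ c₁ (solve (i ∷ j ∷ t ∷ p ∷ M ∷ [])))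
                                    (≤-byDifference _ c₇ (solve (i ∷ j ∷ t ∷ p ∷ M ∷ [])))
                                    (≤-byDifference _ c₆ (solve (i ∷ j ∷ t ∷ p ∷ M ∷ []))))
      , i≤j-k⇒k≤j-i {j = j} (⊔₄-≤⁺ (≤-byDifference _ c₃ (solve (i ∷ j ∷ t ∷ p ∷ M ∷ [])))
                                    (≤-byDifference _ c₂ (solve (i ∷ j ∷ t ∷ p ∷ M ∷ [])))
                                    (≤-byDifference _ c₅ (solve (i ∷ j ∷ t ∷ p ∷ M ∷ [])))
                                    (≤-byDifference _ c₈ (solve (i ∷ j ∷ t ∷ p ∷ M ∷ [])))) )

Cond-m1m1ᶻ⇔cells : ∀ M i j t p → Cond-m1m1ᶻ M (i , j , t , p) ⇔ NonNegativeCells M (+ 1 + M) (+ 1 + M) (i , j , t , p)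
Cond-m1m1ᶻ⇔cells M i j t p = mk⇔ to from
  where
  to : Cond-m1m1ᶻ M (i , j , t , p) → NonNegativeCells M (+ 1 + M) (+ 1 + M) (i , j , t , p)
  to (_ , _ , _ , lower , upper)
    with ⊔₄-≤⁻ (i+j≤k⇒j≤k-i {i = i + j - M} lower) | ≤-⊓₄⁻ (k≤i+j⇒k-i≤j {i = i + j - M} upper)
  ... | l₁ , l₂ , l₃ , l₄ | u₁ , u₂ , u₃ , u₄ =
    0≤-byDifference l₂ (solve (i ∷ j ∷ t ∷ p ∷ M ∷ []))
    , 0≤-byDifference u₂ (solve (i ∷ j ∷ t ∷ p ∷ M ∷ []))
    , 0≤-byDifference u₁ (solve (i ∷ j ∷ t ∷ p ∷ M ∷ []))
    , 0≤-byDifference l₁ (solve (i ∷ j ∷ t ∷ p ∷ M ∷ []))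
    , 0≤-byDifference u₄ (solve (i ∷ j ∷ t ∷ p ∷ M ∷ []))
    , 0≤-byDifference l₄ (solve (i ∷ j ∷ t ∷ p ∷ M ∷ []))
    , 0≤-byDifference l₃ (solve (i ∷ j ∷ t ∷ p ∷ M ∷ []))
    , 0≤-byDifference u₃ (solve (i ∷ j ∷ t ∷ p ∷ M ∷ []))
  from : NonNegativeCells M (+ 1 + M) (+ 1 + M) (i , j , t , p) → Cond-m1m1ᶻ M (i , j , t , p)
  from (c₁ , c₂ , c₃ , c₄ , c₅ , c₆ , c₇ , c₈) =
    ( ≤-byDifference _ (0≤+ c₁ c₂) (solve (i ∷ j ∷ t ∷ p ∷ M ∷ []))
    , ≤-byDifference _ (0≤+ c₄ c₃) (solve (i ∷ j ∷ t ∷ p ∷ M ∷ [])) )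
    , ( ≤-byDifference _ (0≤+ c₁ c₃) (solve (i ∷ j ∷ t ∷ p ∷ M ∷ []))
      , ≤-byDifference _ (0≤+ c₄ c₂) (solve (i ∷ j ∷ t ∷ p ∷ M ∷ [])) )
    , ( j≤k-i⇒i+j≤k {j = (i + j - M - + 1) ⊔ (M - i - j)} {i = + 1}
        (⊔-≤⁺ (≤-byDifference _ (0≤+ c₅ c₄) (solve (i ∷ j ∷ t ∷ p ∷ M ∷ [])))
              (≤-byDifference _ (0≤+ c₈ c₁) (solve (i ∷ j ∷ t ∷ p ∷ M ∷ []))))
      , i≤j-k⇒k≤j-i {j = M + + 1} (absℤ-≤ (i - j) (≤-byDifference _ (0≤+ c₆ c₃) (solve (i ∷ j ∷ t ∷ p ∷ M ∷ [])))
                                              (≤-byDifference _ (0≤+ c₇ c₂) (solve (i ∷ j ∷ t ∷ p ∷ M ∷ [])))) )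
    , ( j≤k-i⇒i+j≤k {i = i + j - M} (⊔₄-≤⁺ (≤-byDifference _ c₄ (solve (i ∷ j ∷ t ∷ p ∷ M ∷ [])))
                                            (≤-byDifference _ c₁ (solve (i ∷ j ∷ t ∷ p ∷ M ∷ [])))
                                            (≤-byDifference _ c₇ (solve (i ∷ j ∷ t ∷ p ∷ M ∷ [])))
                                            (≤-byDifference _ c₆ (solve (i ∷ j ∷ t ∷ p ∷ M ∷ []))))
      , k-i≤j⇒k≤i+j {i = i + j - M} (≤-⊓₄⁺ (≤-byDifference _ c₃ (solve (i ∷ j ∷ t ∷ p ∷ M ∷ [])))
                                            (≤-byDifference _ c₂ (solve (i ∷ j ∷ t ∷ p ∷ M ∷ [])))
                                            (≤-byDifference _ c₈ (solve (i ∷ j ∷ t ∷ p ∷ M ∷ [])))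
                                            (≤-byDifference _ c₅ (solve (i ∷ j ∷ t ∷ p ∷ M ∷ [])))) )

i-[i-j]≡j : ∀ i j → i - (i - j) ≡ j
i-[i-j]≡j = solve-∀

-- ρ(y, S ─ z) and ρ(S ─ y, z) in terms of ρ(y, z), where |x₀| = M, |y| = A and |z| = B.
complementʳ complementˡ : ℤ → ℤ → Quad → Quad
complementʳ M A (i , j , t , p) = i , M - j , A - t , i - p
complementˡ M B (i , j , t , p) = M - i , j , B - t , j - p

complementʳ-involutive : ∀ M A q → complementʳ M A (complementʳ M A q) ≡ q
complementʳ-involutive M A (i , j , t , p) =
  ≡-quadruple refl (i-[i-j]≡j M j) (i-[i-j]≡j A t) (i-[i-j]≡j i p)

complementˡ-involutive : ∀ M B q → complementˡ M B (complementˡ M B q) ≡ q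
complementˡ-involutive M B (i , j , t , p) =
  ≡-quadruple (i-[i-j]≡j M i) refl (i-[i-j]≡j B t) (i-[i-j]≡j j p)

complementʳ-cells : ∀ {M A B B'} → B' ≡ M + M + + 1 - B →
                    ∀ q → NonNegativeCells M A B q → NonNegativeCells M A B' (complementʳ M A q)
complementʳ-cells {M} {A} {B} refl (i , j , t , p) = permute i j t p
  where
  permute : ∀ i j t p → NonNegativeCells M A B (i , j , t , p) →
            NonNegativeCells M A (M + M + + 1 - B) (i , M - j , A - t , i - p)
  permute i j t p (c₁ , c₂ , c₃ , c₄ , c₅ , c₆ , c₇ , c₈) =
    c₂ , 0≤-byDifference c₁ (solve (i ∷ j ∷ t ∷ p ∷ M ∷ A ∷ B ∷ []))
    , 0≤-byDifference c₄ (solve (i ∷ j ∷ t ∷ p ∷ M ∷ A ∷ B ∷ []))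
    , 0≤-byDifference c₃ (solve (i ∷ j ∷ t ∷ p ∷ M ∷ A ∷ B ∷ []))
    , 0≤-byDifference c₆ (solve (i ∷ j ∷ t ∷ p ∷ M ∷ A ∷ B ∷ []))
    , 0≤-byDifference c₅ (solve (i ∷ j ∷ t ∷ p ∷ M ∷ A ∷ B ∷ []))
    , 0≤-byDifference c₈ (solve (i ∷ j ∷ t ∷ p ∷ M ∷ A ∷ B ∷ []))
    , 0≤-byDifference c₇ (solve (i ∷ j ∷ t ∷ p ∷ M ∷ A ∷ B ∷ []))

complementˡ-cells : ∀ {M A A' B} → A' ≡ M + M + + 1 - A →
                    ∀ q → NonNegativeCells M A B q → NonNegativeCells M A' B (complementˡ M B q)
complementˡ-cells {M} {A} {_} {B} refl (i , j , t , p) = permute i j t p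
  where
  permute : ∀ i j t p → NonNegativeCells M A B (i , j , t , p) →
            NonNegativeCells M (M + M + + 1 - A) B (M - i , j , B - t , j - p)
  permute i j t p (c₁ , c₂ , c₃ , c₄ , c₅ , c₆ , c₇ , c₈) =
    c₃ , 0≤-byDifference c₄ (solve (i ∷ j ∷ t ∷ p ∷ M ∷ A ∷ B ∷ []))
    , 0≤-byDifference c₁ (solve (i ∷ j ∷ t ∷ p ∷ M ∷ A ∷ B ∷ []))
    , 0≤-byDifference c₂ (solve (i ∷ j ∷ t ∷ p ∷ M ∷ A ∷ B ∷ []))
    , 0≤-byDifference c₇ (solve (i ∷ j ∷ t ∷ p ∷ M ∷ A ∷ B ∷ []))
    , 0≤-byDifference c₈ (solve (i ∷ j ∷ t ∷ p ∷ M ∷ A ∷ B ∷ []))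
    , 0≤-byDifference c₅ (solve (i ∷ j ∷ t ∷ p ∷ M ∷ A ∷ B ∷ []))
    , 0≤-byDifference c₆ (solve (i ∷ j ∷ t ∷ p ∷ M ∷ A ∷ B ∷ []))

cells-of-point : ∀ {M a u v w} → 0ℤ ≤ℤ a → 0ℤ ≤ℤ u → 0ℤ ≤ℤ v → 0ℤ ≤ℤ w →
                 a + u + v ≤ℤ M → a + u + w ≤ℤ M → a + v + w ≤ℤ M → M ≤ℤ + 1 + (a + a + u + v + w) →
                 NonNegativeCells M M M (a + u , a + v , a + w , a)
cells-of-point {M} {a} {u} {v} {w} 0≤a 0≤u 0≤v 0≤w h₁ h₂ h₃ h₄ =
  0≤a
  , 0≤-byDifference 0≤u (solve (a ∷ u ∷ []))
  , 0≤-byDifference 0≤v (solve (a ∷ v ∷ []))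
  , 0≤-byDifference h₁ (solve (M ∷ a ∷ u ∷ v ∷ []))
  , 0≤-byDifference 0≤w (solve (a ∷ w ∷ []))
  , 0≤-byDifference h₂ (solve (M ∷ a ∷ u ∷ w ∷ []))
  , 0≤-byDifference h₃ (solve (M ∷ a ∷ v ∷ w ∷ []))
  , 0≤-byDifference h₄ (solve (M ∷ a ∷ u ∷ v ∷ w ∷ []))

cells⇒point-bounds : ∀ {M i j t p} → NonNegativeCells M M M (i , j , t , p) →
                     p + (i - p) + (j - p) ≤ℤ M × p + (i - p) + (t - p) ≤ℤ M × p + (j - p) + (t - p) ≤ℤ M
                     × M ≤ℤ + 1 + (p + p + (i - p) + (j - p) + (t - p))
cells⇒point-bounds {M} {i} {j} {t} {p} (_ , _ , _ , c₄ , _ , c₆ , c₇ , c₈) =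
  ≤-byDifference _ c₄ (solve (M ∷ i ∷ j ∷ p ∷ []))
  , ≤-byDifference _ c₆ (solve (M ∷ i ∷ t ∷ p ∷ []))
  , ≤-byDifference _ c₇ (solve (M ∷ j ∷ t ∷ p ∷ []))
  , ≤-byDifference _ c₈ (solve (M ∷ i ∷ j ∷ t ∷ p ∷ []))

embed-cells : ∀ m x → Admissible m x → NonNegativeCells (+ m) (+ m) (+ m) (embed x)
embed-cells m (a , u , v , w) (h₁ , h₂ , h₃ , h₄) =
  cells-of-point (+≤+ ℕ.z≤n) (+≤+ ℕ.z≤n) (+≤+ ℕ.z≤n) (+≤+ ℕ.z≤n)
                 (+≤+ h₁) (+≤+ h₂) (+≤+ h₃) (+≤+ h₄)

cells⇒embed : ∀ m i j t p → NonNegativeCells (+ m) (+ m) (+ m) (i , j , t , p) →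
              Image embed (Admissible m) (i , j , t , p)
cells⇒embed m i j t p cells@(c₁ , c₂ , c₃ , _ , c₅ , _)
  with b₁ , b₂ , b₃ , b₄ ← cells⇒point-bounds cells =
  (∣ p ∣ , ∣ i - p ∣ , ∣ j - p ∣ , ∣ t - p ∣) ,
  ( ℤP.drop‿+≤+ (subst (_≤ℤ + m) (sym (cong₂ _+_ (cong₂ _+_ (n c₁) (n c₂)) (n c₃))) b₁)
  , ℤP.drop‿+≤+ (subst (_≤ℤ + m) (sym (cong₂ _+_ (cong₂ _+_ (n c₁) (n c₂)) (n c₅))) b₂)
  , ℤP.drop‿+≤+ (subst (_≤ℤ + m) (sym (cong₂ _+_ (cong₂ _+_ (n c₁) (n c₃)) (n c₅))) b₃)
  , ℤP.drop‿+≤+ (subst (λ s → + m ≤ℤ + 1 + s)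
                       (sym (cong₂ _+_ (cong₂ _+_ (cong₂ _+_ (cong₂ _+_ (n c₁) (n c₁)) (n c₂)) (n c₃)) (n c₅))) b₄) ) ,
  coordinates c₁ c₂ c₃ c₅
  where
  n : ∀ {x} → 0ℤ ≤ℤ x → + ∣ x ∣ ≡ x
  n = ℤP.0≤i⇒+∣i∣≡i

embed-image⇔cells : ∀ m q → Image embed (Admissible m) q ⇔ NonNegativeCells (+ m) (+ m) (+ m) q
embed-image⇔cells m q@(i , j , t , p) =
  mk⇔ (λ (x , admissible , eq) → subst (NonNegativeCells (+ m) (+ m) (+ m)) eq (embed-cells m x admissible))
      (cells⇒embed m i j t p)

cells-mm-enumerates : ∀ m → Enumerates (NonNegativeCells (+ m) (+ m) (+ m)) (map embed (map fromComposition (quintuples m)))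
cells-mm-enumerates m =
  enumerates-⇔ (embed-image⇔cells m) (enumerates-image embed (λ _ _ → embed-injective) (admissible-enumerates m))

cells-mm1-enumerates : ∀ {M xs} → Enumerates (NonNegativeCells M M M) xs →
                       Enumerates (NonNegativeCells M M (+ 1 + M)) (map (complementʳ M M) xs)
cells-mm1-enumerates {M} = enumerates-involution (complementʳ M M) (complementʳ-involutive M M)
  (complementʳ-cells {M} {M} {M} {+ 1 + M} (solve (M ∷ [])))
  (complementʳ-cells {M} {M} {+ 1 + M} {M} (solve (M ∷ [])))

cells-m1m-enumerates : ∀ {M xs} → Enumerates (NonNegativeCells M M M) xs →
                       Enumerates (NonNegativeCells M (+ 1 + M) M) (map (complementˡ M M) xs)
cells-m1m-enumerates {M} = enumerates-involution (complementˡ M M) (complementˡ-involutive M M)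
  (complementˡ-cells {M} {M} {+ 1 + M} {M} (solve (M ∷ [])))
  (complementˡ-cells {M} {+ 1 + M} {M} {M} (solve (M ∷ [])))

cells-m1m1-enumerates : ∀ {M xs} → Enumerates (NonNegativeCells M M (+ 1 + M)) xs →
                        Enumerates (NonNegativeCells M (+ 1 + M) (+ 1 + M)) (map (complementˡ M (+ 1 + M)) xs)
cells-m1m1-enumerates {M} = enumerates-involution (complementˡ M (+ 1 + M)) (complementˡ-involutive M (+ 1 + M))
  (complementˡ-cells {M} {M} {+ 1 + M} {+ 1 + M} (solve (M ∷ [])))
  (complementˡ-cells {M} {+ 1 + M} {M} {+ 1 + M} (solve (M ∷ [])))

describes : ∀ {m a b Cond xs} → (∀ q → Cond q ⇔ NonNegativeCells (+ m) (+ a) (+ b) q) →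
            Enumerates (NonNegativeCells (+ m) (+ a) (+ b)) xs → length xs ≡ (m ℕ.+ 4) C 4 → Describes m a b Cond
describes {m} {a} {b} {xs = xs} Cond⇔cells (unique , ∈⇔cells) length≡ =
  (λ q → ⇔-sym (Cond⇔cells q) ⇔-∘ In𝓘⇔cells m a b q)
  , xs , unique , (λ q → ⇔-sym (In𝓘⇔cells m a b q) ⇔-∘ ∈⇔cells q) , length≡

proposition3p1 : (m : ℕ) → 1 ≤ m →
    Describes m m m (Cond-mm m)
    × Describes m m (suc m) (Cond-mm1 m)
    × Describes m (suc m) m (Cond-m1m m)
    × Describes m (suc m) (suc m) (Cond-m1m1 m)
proposition3p1 m _ =
  describes (λ (i , j , t , p) → Cond-mmᶻ⇔cells M i j t p) enumeration-mm length≡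
  , describes (λ (i , j , t , p) → Cond-mm1ᶻ⇔cells M i j t p) enumeration-mm1
              (trans (length-map (complementʳ M M) points) length≡)
  , describes (λ (i , j , t , p) → Cond-m1mᶻ⇔cells M i j t p) (cells-m1m-enumerates {M = M} enumeration-mm)
              (trans (length-map (complementˡ M M) points) length≡)
  , describes (λ (i , j , t , p) → Cond-m1m1ᶻ⇔cells M i j t p) (cells-m1m1-enumerates {M = M} enumeration-mm1)
              (trans (length-map (complementˡ M (+ 1 + M)) (map (complementʳ M M) points))
                     (trans (length-map (complementʳ M M) points) length≡))
  where
  M : ℤ
  M = + m
  points : List Quad
  points = map embed (map fromComposition (quintuples m))
  enumeration-mm : Enumerates (NonNegativeCells M M M) points
  enumeration-mm = cells-mm-enumerates m
  enumeration-mm1 : Enumerates (NonNegativeCells M M (+ 1 + M)) (map (complementʳ M M) points)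
  enumeration-mm1 = cells-mm1-enumerates {M = M} enumeration-mm
  length≡ : length points ≡ (m ℕ.+ 4) C 4
  length≡ = trans (length-map embed (map fromComposition (quintuples m)))
                  (trans (length-map fromComposition (quintuples m)) (length-quintuples m))
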